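{- Let $\varphi=\frac{1+\sqrt5}{2}$, let $F=0100101001001010010\ldots$ be the Fibonacci word (the cutting sequence of the line $y=\varphi x$), and let $S^M=01020101020102010102\ldots$ be the ternary word obtained from $F$ by replacing every factor $00$ by $020$. For every integer $n\ge1$, in the Rauzy graph $G_n(S^M)$ every vertex has out-degree $1$, except exactly one vertex, which has out-degree $2$.
   Context: The cutting sequence of a line $y=\lambda x$ ($\lambda>0$) is the binary word obtained by following the line from the origin and writing $0$ for each meeting with a horizontal grid line $y=k$ and $1$ for each meeting with a vertical grid line $x=k$ ($k$ a positive integer). For an infinite word $x$ over an alphabet $A$, $f_n(x)$ denotes the set of factors (blocks of consecutive letters) of $x$ of length $n$. The Rauzy graph $G_n(x)$ of order $n$ is the directed graph with vertex set $f_n(x)$ and an edge from $bv$ to $va$ (for $a,b\in A$) whenever $bva\in f_{n+1}(x)$. -}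

module Defs where

open import Data.Nat using (ℕ; zero; suc; _+_; _*_; _∸_; _≤ᵇ_; _<ᵇ_)
open import Data.Bool using (Bool; true; false; if_then_else_; _∨_; _∧_)
open import Data.Fin using (Fin; zero; suc)
open import Data.List using (List; []; _∷_; _++_; [_]; length; applyUpTo; concat; replicate)
open import Data.Nat.ListAction using (sum)
open import Data.List.Relation.Unary.Unique.Propositional using (Unique)
open import Data.List.Membership.Propositional using (_∈_)
open import Data.Product using (Σ; ∃-syntax; _×_)
open import Function.Bundles using (_⇔_)
open import Relation.Binary.PropositionalEquality using (_≡_)

Word : Set → Set
Word A = ℕ → A

nth : {A : Set} → List A → ℕ → A → A
nth []       _       d = d
nth (x ∷ _)  zero    _ = x
nth (_ ∷ xs) (suc i) d = nth xs i d

-- The golden ratio φ = (1+√5)/2, handled exactly via integer arithmetic.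
-- belowMulφ k m = true  iff  k < m·φ,
-- i.e. 2k < m + m√5, i.e. 2k ≤ m  or  (2k − m)² < 5m².

belowMulφ : ℕ → ℕ → Bool
belowMulφ k m = ((2 * k) ≤ᵇ m) ∨ (((2 * k ∸ m) * (2 * k ∸ m)) <ᵇ (5 * (m * m)))

-- ⌊m·φ⌋ = #{ k ∈ [1, 2m] : k < m·φ }   (valid since m·φ < 2m).
floorMulφ : ℕ → ℕ
floorMulφ m = sum (applyUpTo (λ i → if belowMulφ (suc i) m then 1 else 0) (2 * m))

-- Cutting sequence of the line y = λx (λ > 0 irrational), given the
-- function m ↦ ⌊mλ⌋.  Following the line from the origin, between the
-- vertical grid lines x = m−1 and x = m it meets exactly
-- ⌊mλ⌋ − ⌊(m−1)λ⌋ horizontal lines y = k (those with k < mλ, i.e. k/λ < m),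
-- and then meets x = m.  Letter 0 = horizontal line, 1 = vertical line.

cutBlock : (ℕ → ℕ) → ℕ → List (Fin 2)
cutBlock fl m = replicate (fl m ∸ fl (m ∸ 1)) zero ++ [ suc zero ]

-- the concatenation of the first N blocks (length ≥ N)
cutPrefix : (ℕ → ℕ) → ℕ → List (Fin 2)
cutPrefix fl N = concat (applyUpTo (λ i → cutBlock fl (suc i)) N)

cuttingSequence : (ℕ → ℕ) → Word (Fin 2)
cuttingSequence fl i = nth (cutPrefix fl (suc i)) i zero

F : Word (Fin 2)
F = cuttingSequence floorMulφ

-- S^M : obtained from F by replacing every factor 00 by 020,
-- i.e. inserting the letter 2 between any two consecutive 0's.

isZero : {n : ℕ} → Fin (suc n) → Bool
isZero zero    = true
isZero (suc _) = false

embed : Fin 2 → Fin 3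
embed zero          = zero
embed (suc zero)    = suc zero

SMpiece : ℕ → List (Fin 3)
SMpiece i = embed (F i) ∷ (if isZero (F i) ∧ isZero (F (suc i)) then [ suc (suc zero) ] else [])

SM : Word (Fin 3)
SM j = nth (concat (applyUpTo SMpiece (suc j))) j zero

factorAt : {A : Set} → Word A → ℕ → ℕ → List A
factorAt x i n = applyUpTo (λ j → x (i + j)) n

IsFactor : {A : Set} → Word A → List A → Set
IsFactor x w = ∃[ i ] factorAt x i (length w) ≡ w

IsVertex : {A : Set} → Word A → ℕ → List A → Set
IsVertex x n u = IsFactor x u × length u ≡ n

Edge : {A : Set} → Word A → List A → List A → Set
Edge {A} x u w = Σ A λ b → Σ (List A) λ v → Σ A λ a →
  (u ≡ b ∷ v) × (w ≡ v ++ [ a ]) × IsFactor x (b ∷ v ++ [ a ])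

HasOutDegree : {A : Set} → Word A → List A → ℕ → Set
HasOutDegree {A} x u d = Σ (List (List A)) λ ws →
  (length ws ≡ d) × Unique ws × (∀ w → (w ∈ ws) ⇔ Edge x u w)

-- Every other letter of S^M is 0, and the letters in between are 1 + s for the balanced binary
-- word s whose prefix of length t contains ⌊(t + 1)/φ⌋ zeros.  A vertex of G_n(S^M) has out-degree 2
-- exactly when it is followed by both 1 and 2, and since the zeros fix the parity of its occurrences,
-- such right special factors correspond to the right special factors of s of length ⌊n/2⌋.  There is
-- at most one of those, as two would produce factors 0w0 and 1w1 of s; and there is one, since
-- otherwise a repeated factor would force s to be periodic from some point on, giving ⌊x/φ⌋ a rational
-- slope.  Arithmetic with φ is exact throughout: k < φm iff (2k − m)² < 5m².

module Submission where

open import Defs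
open import Data.Bool using (Bool; true; false; T; not; if_then_else_; _xor_)
open import Data.Bool.Properties using (T-∨; not-distribˡ-xor; not-involutive; xor-same)
open import Data.Empty using (⊥; ⊥-elim)
open import Data.Fin as Fin using (Fin; toℕ; fromℕ<; funToFin; finToFun)
open import Data.Fin.Patterns using (0F; 1F; 2F)
open import Data.Fin.Properties using (pigeonhole; toℕ-fromℕ<; finToFun-funToFin) renaming (_≟_ to _≟ᶠ_; suc-injective to Fin-suc-injective)
open import Data.List using (List; []; _∷_; _++_; [_]; length; applyUpTo; concat; replicate)
open import Data.List.Properties using (∷-injective; applyUpTo-∷ʳ; concat-++; ++-identityʳ; ++-assoc; length-++; length-replicate; ∷ʳ-injective; ∷ʳ-injectiveʳ; length-applyUpTo)
open import Data.List.Membership.Propositional using (_∈_)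
open import Data.List.Relation.Unary.All using ([]; _∷_)
open import Data.List.Relation.Unary.AllPairs using ([]; _∷_)
open import Data.List.Relation.Unary.Any using (here; there)
open import Data.Nat
open import Data.Nat.Divisibility using (_∣_; divides)
open import Data.Nat.ListAction using (sum)
open import Data.Nat.Primality using (prime?; euclidsLemma)
open import Data.Nat.Properties
open import Data.Nat.Tactic.RingSolver using (solve-∀)
open import Data.Product using (Σ; _×_; _,_; ∃-syntax; proj₁; proj₂)
open import Data.Sum using (_⊎_; inj₁; inj₂)
open import Data.Unit using (tt)
open import Function.Base using (_∘_; _$_)
open import Function.Bundles using (_⇔_; mk⇔; Equivalence)
open import Relation.Binary.Definitions using (tri<; tri≈; tri>)
open import Relation.Binary.PropositionalEquality hiding ([_])
open import Relation.Nullary using (¬_; Dec; yes; no; does; contradiction)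
open import Relation.Nullary.Decidable using (toWitness; map′)

open Equivalence using (to; from)

private variable
  A : Set
  a b c d i j k k′ m m′ n s t x : ℕ

-- Exact arithmetic with φ

sq-mono-≤ : s ≤ t → s * s ≤ t * t
sq-mono-≤ s≤t = *-mono-≤ s≤t s≤t

sq-cancel-< : s * s < t * t → s < t
sq-cancel-< {s} {t} lt with s <? t
... | yes s<t = s<t
... | no s≮t = contradiction lt (≤⇒≯ (sq-mono-≤ (≮⇒≥ s≮t)))

sq-+ : ∀ s t → (s + t) * (s + t) ≡ s * s + 2 * (s * t) + t * t
sq-+ = solve-∀

c*sq-+ : ∀ c s t → c * ((s + t) * (s + t)) ≡ c * (s * s) + 2 * (c * (s * t)) + c * (t * t)
c*sq-+ = solve-∀

c*-interchange : ∀ c b d → (c * (b * b)) * (c * (d * d)) ≡ (c * (b * d)) * (c * (b * d))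
c*-interchange = solve-∀

-- The cross term is controlled by Cauchy–Schwarz: st < c·bd.
sq-+-< : ∀ c → s * s < c * (b * b) → t * t < c * (d * d) → (s + t) * (s + t) < c * ((b + d) * (b + d))
sq-+-< {s} {b} {t} {d} c ss<cbb tt<cdd = begin-strict
  (s + t) * (s + t)                               ≡⟨ sq-+ s t ⟩
  s * s + 2 * (s * t) + t * t                     <⟨ +-mono-< (+-mono-<-≤ ss<cbb (*-monoʳ-≤ 2 (<⇒≤ st<cbd))) tt<cdd ⟩
  c * (b * b) + 2 * (c * (b * d)) + c * (d * d)   ≡⟨ sym (c*sq-+ c b d) ⟩
  c * ((b + d) * (b + d))                         ∎
  where
  open ≤-Reasoning
  st<cbd : s * t < c * (b * d)
  st<cbd = sq-cancel-< (subst₂ _<_ ([m*n]*[o*p]≡[m*o]*[n*p] s s t t) (c*-interchange c b d) (*-mono-< ss<cbb tt<cdd))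

sq-+-> : ∀ c → c * (b * b) < s * s → c * (d * d) < t * t → c * ((b + d) * (b + d)) < (s + t) * (s + t)
sq-+-> {b} {s} {d} {t} c cbb<ss cdd<tt = begin-strict
  c * ((b + d) * (b + d))                         ≡⟨ c*sq-+ c b d ⟩
  c * (b * b) + 2 * (c * (b * d)) + c * (d * d)   <⟨ +-mono-< (+-mono-<-≤ cbb<ss (*-monoʳ-≤ 2 (<⇒≤ cbd<st))) cdd<tt ⟩
  s * s + 2 * (s * t) + t * t                     ≡⟨ sym (sq-+ s t) ⟩
  (s + t) * (s + t)                               ∎
  where
  open ≤-Reasoning
  cbd<st : c * (b * d) < s * t
  cbd<st = sq-cancel-< (subst₂ _<_ (c*-interchange c b d) ([m*n]*[o*p]≡[m*o]*[n*p] s s t t) (*-mono-< cbb<ss cdd<tt))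

5∣sq⇒5∣ : ∀ t → 5 ∣ t * t → 5 ∣ t
5∣sq⇒5∣ t 5∣tt with euclidsLemma t t (toWitness {a? = prime? 5} _) 5∣tt
... | inj₁ 5∣t = 5∣t
... | inj₂ 5∣t = 5∣t

square-fifth : ∀ s m → (s * 5) * (s * 5) ≡ 5 * (m * m) → m * m ≡ 5 * (s * s)
square-fifth s m eq = *-cancelˡ-≡ (m * m) (5 * (s * s)) 5 (trans (sym eq) (arith s))
  where
  arith : ∀ s → (s * 5) * (s * 5) ≡ 5 * (5 * (s * s))
  arith = solve-∀

√5-descent : s * s ≡ 5 * (m * m) → ∃[ s₅ ] ∃[ m₅ ] s ≡ s₅ * 5 × m ≡ m₅ * 5 × s₅ * s₅ ≡ 5 * (m₅ * m₅)
√5-descent {s} {m} eq with 5∣sq⇒5∣ s (divides (m * m) (trans eq (*-comm 5 (m * m))))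
... | divides s₅ refl with 5∣sq⇒5∣ m (divides (s₅ * s₅) (trans (square-fifth s₅ m eq) (*-comm 5 (s₅ * s₅))))
...   | divides m₅ refl = s₅ , m₅ , refl , refl , square-fifth m₅ s₅ (square-fifth s₅ (m₅ * 5) eq)

√5-irrational : s * s ≡ 5 * (m * m) → m ≡ 0
√5-irrational {s} {m} = descent s ≤-refl
  where
  sq≡0 : ∀ m → m * m ≡ 0 → m ≡ 0
  sq≡0 zero _ = refl
  descent : ∀ fuel {s m} → s ≤ fuel → s * s ≡ 5 * (m * m) → m ≡ 0
  descent zero {m = m} z≤n eq = sq≡0 m (*-cancelˡ-≡ (m * m) 0 5 (sym eq))
  descent (suc fuel) {s} {m} s≤fuel eq with √5-descent {s} {m} eq
  ... | s₅ , m₅ , refl , refl , eq₅ = cong (_* 5) (descent fuel {s₅} {m₅} (shrink s₅ s≤fuel) eq₅)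
    where
    shrink : ∀ x → x * 5 ≤ suc fuel → x ≤ fuel
    shrink zero    _ = z≤n
    shrink (suc x) h = s≤s⁻¹ (≤-trans (m<m*n (suc x) 5 (s≤s (s≤s z≤n))) h)

infix 4 _<φ_ _>φ_ _<φ?_

-- k <φ m and k >φ m mean k < φ·m and k > φ·m: as 2φ = 1 + √5 they compare (2k − m)² with 5m², and
-- truncating 2k − m at 0 does not change the outcome.
record _<φ_ (k m : ℕ) : Set where
  constructor mk<φ
  field <φ-sq : (2 * k ∸ m) * (2 * k ∸ m) < 5 * (m * m)

record _>φ_ (k m : ℕ) : Set where
  constructor mk>φ
  field >φ-sq : 5 * (m * m) < (2 * k ∸ m) * (2 * k ∸ m)

-- Opaque, so that does (k <φ? m) stays stuck in ⌊_/φ⌋ below and with-abstraction can see it.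
opaque
  _<φ?_ : ∀ k m → Dec (k <φ m)
  k <φ? m = map′ mk<φ _<φ_.<φ-sq (_ <? _)

<φ-mono : k′ ≤ k → m ≤ m′ → k <φ m → k′ <φ m′
<φ-mono k′≤k m≤m′ (mk<φ k<φm) = mk<φ $ ≤-<-trans (sq-mono-≤ (∸-mono (*-monoʳ-≤ 2 k′≤k) m≤m′))
  (<-≤-trans k<φm (*-monoʳ-≤ 5 (sq-mono-≤ m≤m′)))

>φ-mono : k ≤ k′ → m′ ≤ m → k >φ m → k′ >φ m′
>φ-mono k≤k′ m′≤m (mk>φ k>φm) = mk>φ $ <-≤-trans (≤-<-trans (*-monoʳ-≤ 5 (sq-mono-≤ m′≤m)) k>φm)
  (sq-mono-≤ (∸-mono (*-monoʳ-≤ 2 k≤k′) m′≤m))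

<φ-asym : k <φ m → ¬ k >φ m
<φ-asym (mk<φ lt) (mk>φ gt) = <-asym lt gt

¬<φ0 : ¬ k <φ 0
¬<φ0 (mk<φ ())

2*∸≤ : k ≤ m → 2 * k ∸ m ≤ m
2*∸≤ {k} {m} k≤m = ≤-trans (∸-monoˡ-≤ m (*-monoʳ-≤ 2 k≤m)) (≤-reflexive (trans (m+n∸m≡n m (m + 0)) (+-identityʳ m)))

≤⇒<φ : k ≤ m → 1 ≤ m → k <φ m
≤⇒<φ {k} {suc m} k≤m _ = mk<φ $ ≤-<-trans (sq-mono-≤ (2*∸≤ k≤m))
  (subst (suc m * suc m <_) (*-comm (suc m * suc m) 5) (m<m*n (suc m * suc m) 5 (s≤s (s≤s z≤n))))

≤⇒≯φ : k ≤ m → ¬ k >φ m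
≤⇒≯φ {k} {m} k≤m (mk>φ k>φm) = ≤⇒≯ (≤-trans (sq-mono-≤ (2*∸≤ k≤m)) (m≤n*m (m * m) 5)) k>φm

>φ⇒< : k >φ m → m < 2 * k
>φ⇒< {k} {m} (mk>φ k>φm) with m <? 2 * k
... | yes m<2k = m<2k
... | no m≮2k = contradiction k>φm (subst (λ z → ¬ 5 * (m * m) < z * z) (sym (m≤n⇒m∸n≡0 (≮⇒≥ m≮2k))) n≮0)

<φ⊎>φ : 1 ≤ k → k <φ m ⊎ k >φ m
<φ⊎>φ {suc k} {m} _ with <-cmp ((2 * suc k ∸ m) * (2 * suc k ∸ m)) (5 * (m * m))
... | tri< lt _ _ = inj₁ (mk<φ lt)
... | tri> _ _ gt = inj₂ (mk>φ gt)
... | tri≈ _ eq _ with √5-irrational {2 * suc k ∸ m} {m} eq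
... | refl = contradiction eq λ ()

¬2*<φ : ¬ 2 * m <φ m
¬2*<φ {m} (mk<φ lt) = ≤⇒≯ (≤-trans (*-monoˡ-≤ (m * m) 5≤9) (≤-reflexive (arith₂ m)))
  (subst (λ s → s * s < 5 * (m * m)) 3m lt)
  where
  arith₁ : ∀ m → 2 * (2 * m) ≡ m + 3 * m
  arith₁ = solve-∀
  arith₂ : ∀ m → 9 * (m * m) ≡ (3 * m) * (3 * m)
  arith₂ = solve-∀
  5≤9 : 5 ≤ 9
  5≤9 = s≤s (s≤s (s≤s (s≤s (s≤s z≤n))))
  3m : 2 * (2 * m) ∸ m ≡ 3 * m
  3m = trans (cong (_∸ m) (arith₁ m)) (m+n∸m≡n m (3 * m))

<φ⇒≤2* : k <φ m → k ≤ 2 * m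
<φ⇒≤2* {k} {m} k<φm with k ≤? 2 * m
... | yes k≤2m = k≤2m
... | no k≰2m = contradiction (<φ-mono (<⇒≤ (≰⇒> k≰2m)) ≤-refl k<φm) ¬2*<φ

∸-+-≤ : ∀ x y a b → (x + y) ∸ (a + b) ≤ (x ∸ a) + (y ∸ b)
∸-+-≤ x y a b = ≤-trans
  (∸-monoˡ-≤ (a + b) (≤-trans (+-mono-≤ (m≤n+m∸n x a) (m≤n+m∸n y b)) (≤-reflexive (shuffle a (x ∸ a) b (y ∸ b)))))
  (≤-reflexive (m+n∸n≡m _ (a + b)))
  where
  shuffle : ∀ a u b v → (a + u) + (b + v) ≡ (u + v) + (a + b)
  shuffle = solve-∀

∸-+-≡ : ∀ {x y a b} → a ≤ x → b ≤ y → (x + y) ∸ (a + b) ≡ (x ∸ a) + (y ∸ b)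
∸-+-≡ {x} {y} {a} {b} a≤x b≤y = begin
  (x + y) ∸ (a + b)                      ≡⟨ cong₂ (λ u v → (u + v) ∸ (a + b)) (sym (m∸n+n≡m a≤x)) (sym (m∸n+n≡m b≤y)) ⟩
  ((x ∸ a + a) + (y ∸ b + b)) ∸ (a + b)  ≡⟨ cong (_∸ (a + b)) (shuffle (x ∸ a) a (y ∸ b) b) ⟩
  ((x ∸ a) + (y ∸ b) + (a + b)) ∸ (a + b) ≡⟨ m+n∸n≡m _ (a + b) ⟩
  (x ∸ a) + (y ∸ b)                      ∎
  where
  open ≡-Reasoning
  shuffle : ∀ u a v b → (u + a) + (v + b) ≡ (u + v) + (a + b)
  shuffle = solve-∀

<φ-+ : a <φ b → c <φ d → a + c <φ b + d
<φ-+ {a} {b} {c} {d} (mk<φ a<φb²) (mk<φ c<φd²) =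
  mk<φ $ ≤-<-trans (sq-mono-≤ diff≤) (sq-+-< {2 * a ∸ b} {b} {2 * c ∸ d} {d} 5 a<φb² c<φd²)
  where
  diff≤ : 2 * (a + c) ∸ (b + d) ≤ (2 * a ∸ b) + (2 * c ∸ d)
  diff≤ = subst (λ z → z ∸ (b + d) ≤ (2 * a ∸ b) + (2 * c ∸ d)) (sym (*-distribˡ-+ 2 a c)) (∸-+-≤ (2 * a) (2 * c) b d)

>φ-+ : a >φ b → c >φ d → a + c >φ b + d
>φ-+ {a} {b} {c} {d} a>φb@(mk>φ a>φb²) c>φd@(mk>φ c>φd²) =
  mk>φ $ subst (λ z → 5 * ((b + d) * (b + d)) < z * z) (sym diff≡) (sq-+-> {b} {2 * a ∸ b} {d} {2 * c ∸ d} 5 a>φb² c>φd²)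
  where
  diff≡ : 2 * (a + c) ∸ (b + d) ≡ (2 * a ∸ b) + (2 * c ∸ d)
  diff≡ = trans (cong (_∸ (b + d)) (*-distribˡ-+ 2 a c))
    (∸-+-≡ {2 * a} {2 * c} {b} {d} (<⇒≤ (>φ⇒< {a} a>φb)) (<⇒≤ (>φ⇒< {c} c>φd)))

+-cross-< : ∀ {a b x y} → a + y ≡ x + b → x < y → a < b
+-cross-< {a} {b} {x} {y} eq x<y = +-cancelʳ-< y a b (begin-strict
  a + y ≡⟨ eq ⟩ x + b <⟨ +-monoˡ-< b x<y ⟩ y + b ≡⟨ +-comm y b ⟩ b + y ∎)
  where open ≤-Reasoning

-- (2k − m)² − 5m² = 4(k² − km − m²), the norm form of ℤ[φ].
norm-identity : 2 * k ≡ s + m → 4 * (k * k) + 5 * (m * m) ≡ s * s + 4 * (k * m + m * m)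
norm-identity {k} {s} {m} eq = begin
  4 * (k * k) + 5 * (m * m)           ≡⟨ id₁ k m ⟩
  (2 * k) * (2 * k) + 5 * (m * m)     ≡⟨ cong (λ z → z * z + 5 * (m * m)) eq ⟩
  (s + m) * (s + m) + 5 * (m * m)     ≡⟨ id₂ s m ⟩
  s * s + (2 * ((s + m) * m) + 4 * (m * m)) ≡⟨ cong (λ z → s * s + (2 * (z * m) + 4 * (m * m))) (sym eq) ⟩
  s * s + (2 * ((2 * k) * m) + 4 * (m * m)) ≡⟨ cong (s * s +_) (id₃ k m) ⟩
  s * s + 4 * (k * m + m * m)         ∎
  where
  open ≡-Reasoning
  id₁ : ∀ k m → 4 * (k * k) + 5 * (m * m) ≡ (2 * k) * (2 * k) + 5 * (m * m)
  id₁ = solve-∀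
  id₂ : ∀ s m → (s + m) * (s + m) + 5 * (m * m) ≡ s * s + (2 * ((s + m) * m) + 4 * (m * m))
  id₂ = solve-∀
  id₃ : ∀ k m → 2 * ((2 * k) * m) + 4 * (m * m) ≡ 4 * (k * m + m * m)
  id₃ = solve-∀

<φ⇔ : k <φ m ⇔ k * k < k * m + m * m
<φ⇔ {k} {m} with m ≤? 2 * k
... | yes m≤2k = mk⇔
  (λ (mk<φ k<φm) → *-cancelˡ-< 4 _ _ (+-cross-< identity k<φm))
  (λ poly → mk<φ $ +-cross-< (sym identity) (*-monoʳ-< 4 poly))
  where
  identity : 4 * (k * k) + 5 * (m * m) ≡ (2 * k ∸ m) * (2 * k ∸ m) + 4 * (k * m + m * m)
  identity = norm-identity {k} {2 * k ∸ m} {m} (sym (m∸n+n≡m m≤2k))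
... | no m≰2k = mk⇔ (λ _ → ≤-<-trans (*-monoʳ-≤ k (<⇒≤ k<m)) (m<m+n (k * m) (*-mono-≤ m≥1 m≥1)))
                    (λ _ → ≤⇒<φ (<⇒≤ k<m) m≥1)
  where
  k<m : k < m
  k<m = ≤-<-trans (m≤m+n k (k + 0)) (≰⇒> m≰2k)
  m≥1 : 1 ≤ m
  m≥1 = ≤-trans (s≤s z≤n) k<m

>φ⇔ : k >φ m ⇔ k * m + m * m < k * k
>φ⇔ {k} {m} with m ≤? 2 * k
... | yes m≤2k = mk⇔
  (λ (mk>φ k>φm) → *-cancelˡ-< 4 _ _ (+-cross-< flipped k>φm))
  (λ poly → mk>φ $ +-cross-< (sym flipped) (*-monoʳ-< 4 poly))
  where
  flipped : 4 * (k * m + m * m) + (2 * k ∸ m) * (2 * k ∸ m) ≡ 5 * (m * m) + 4 * (k * k)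
  flipped = trans (+-comm _ ((2 * k ∸ m) * (2 * k ∸ m)))
    (trans (sym (norm-identity {k} {2 * k ∸ m} {m} (sym (m∸n+n≡m m≤2k)))) (+-comm _ (5 * (m * m))))
... | no m≰2k = mk⇔ (λ k>φm → contradiction k>φm (≤⇒≯φ (<⇒≤ k<m)))
                    (λ poly → contradiction poly (≤⇒≯ (≤-trans (*-monoʳ-≤ k (<⇒≤ k<m)) (m≤m+n (k * m) (m * m)))))
  where
  k<m : k < m
  k<m = ≤-<-trans (m≤m+n k (k + 0)) (≰⇒> m≰2k)

-- Far enough along the ray of (p, g), the integrality of the norm k² − km − m² pushes the
-- multiples of (p, g) more than one unit away from the line k = φm.
>φ-scale : ∀ p g K → p + 2 * g + 2 ≤ K → p >φ g → K * p >φ suc (K * g)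
>φ-scale p g K K≥ p>φg = from >φ⇔ (begin-strict
  (K * p) * suc (K * g) + suc (K * g) * suc (K * g) ≡⟨ id₁ K p g ⟩
  K * K * (p * g + g * g) + (K * (p + 2 * g) + 1)  <⟨ +-monoʳ-< (K * K * (p * g + g * g)) small ⟩
  K * K * (p * g + g * g) + K * K                  ≡⟨ id₄ (K * K) (p * g + g * g) ⟩
  K * K * suc (p * g + g * g)                      ≤⟨ *-monoʳ-≤ (K * K) (to >φ⇔ p>φg) ⟩
  K * K * (p * p)                                  ≡⟨ id₂ K p ⟩
  (K * p) * (K * p)                                ∎)
  where
  open ≤-Reasoning
  id₁ : ∀ K p g → (K * p) * suc (K * g) + suc (K * g) * suc (K * g) ≡ K * K * (p * g + g * g) + (K * (p + 2 * g) + 1)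
  id₁ = solve-∀
  id₂ : ∀ K p → K * K * (p * p) ≡ (K * p) * (K * p)
  id₂ = solve-∀
  id₃ : ∀ K a → K * a + (K + K) ≡ K * (a + 2)
  id₃ = solve-∀
  id₄ : ∀ b a → b * a + b ≡ b * suc a
  id₄ = solve-∀
  small : K * (p + 2 * g) + 1 < K * K
  small = begin-strict
    K * (p + 2 * g) + 1       <⟨ +-monoʳ-< (K * (p + 2 * g)) (≤-trans (s≤s (s≤s z≤n)) (+-mono-≤ K≥1 K≥1)) ⟩
    K * (p + 2 * g) + (K + K) ≡⟨ id₃ K (p + 2 * g) ⟩
    K * (p + 2 * g + 2)       ≤⟨ *-monoʳ-≤ K K≥ ⟩
    K * K                     ∎
    where
    K≥1 : 1 ≤ K
    K≥1 = ≤-trans (m≤n+m 1 (p + 2 * g + 1)) (≤-trans (≤-reflexive (+-assoc (p + 2 * g) 1 1)) K≥)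

<φ-scale : ∀ p g K q → p + 2 * g + 2 ≤ K → p <φ g → K * g ≡ suc q → K * p <φ q
<φ-scale p g K q K≥ p<φg Kg≡ = from <φ⇔ (+-cancelʳ-≤ (K * p + 2 * q + 1) _ _ (begin
  suc ((K * p) * (K * p)) + (K * p + 2 * q + 1) ≡⟨ id₁ (K * p) q ⟩
  (K * p) * (K * p) + (K * p + 2 * suc q)       ≡⟨ cong (λ z → (K * p) * (K * p) + (K * p + 2 * z)) (sym Kg≡) ⟩
  (K * p) * (K * p) + (K * p + 2 * (K * g))     ≤⟨ +-monoʳ-≤ ((K * p) * (K * p)) big ⟩
  (K * p) * (K * p) + K * K                     ≡⟨ id₂ K p ⟩
  K * K * suc (p * p)                           ≤⟨ *-monoʳ-≤ (K * K) (to <φ⇔ p<φg) ⟩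
  K * K * (p * g + g * g)                       ≡⟨ id₃ K p g ⟩
  (K * p) * (K * g) + (K * g) * (K * g)         ≡⟨ cong (λ z → (K * p) * z + z * z) Kg≡ ⟩
  (K * p) * suc q + suc q * suc q               ≡⟨ id₄ (K * p) q ⟩
  ((K * p) * q + q * q) + (K * p + 2 * q + 1)   ∎))
  where
  open ≤-Reasoning
  id₁ : ∀ a q → suc (a * a) + (a + 2 * q + 1) ≡ a * a + (a + 2 * suc q)
  id₁ = solve-∀
  id₂ : ∀ K p → (K * p) * (K * p) + K * K ≡ K * K * suc (p * p)
  id₂ = solve-∀
  id₃ : ∀ K p g → K * K * (p * g + g * g) ≡ (K * p) * (K * g) + (K * g) * (K * g)
  id₃ = solve-∀
  id₄ : ∀ a q → a * suc q + suc q * suc q ≡ (a * q + q * q) + (a + 2 * q + 1)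
  id₄ = solve-∀
  big : K * p + 2 * (K * g) ≤ K * K
  big = begin
    K * p + 2 * (K * g) ≡⟨ id₅ K p g ⟩
    K * (p + 2 * g)     ≤⟨ *-monoʳ-≤ K (≤-trans (m≤m+n (p + 2 * g) 2) K≥) ⟩
    K * K               ∎
    where
    id₅ : ∀ K p g → K * p + 2 * (K * g) ≡ K * (p + 2 * g)
    id₅ = solve-∀

-- ⌊ x /φ⌋ is computed incrementally: as 1/φ < 1 it rises by at most one per step, namely
-- exactly when x + 1 is no longer below φ·(⌊ x /φ⌋ + 1).
⌊_/φ⌋ : ℕ → ℕ
⌊ zero /φ⌋ = zero
⌊ suc x /φ⌋ = if does (suc x <φ? suc ⌊ x /φ⌋) then ⌊ x /φ⌋ else suc ⌊ x /φ⌋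

/φ-upper : ∀ x → x <φ suc ⌊ x /φ⌋
/φ-upper zero = mk<φ (s≤s z≤n)
/φ-upper (suc x) with suc x <φ? suc ⌊ x /φ⌋
... | yes lt = lt
... | no _ = subst₂ _<φ_ (+-comm x 1) (+-comm (suc ⌊ x /φ⌋) 1) (<φ-+ (/φ-upper x) (mk<φ (s≤s (s≤s z≤n))))

/φ-lower : 1 ≤ x → x >φ ⌊ x /φ⌋
/φ-lower {suc x} _ = lower x
  where
  lower : ∀ x → suc x >φ ⌊ suc x /φ⌋
  lower zero with 1 <φ? 1
  ... | yes _ = mk>φ (s≤s z≤n)
  ... | no 1≮φ1 = contradiction (mk<φ (s≤s (s≤s z≤n))) 1≮φ1
  lower (suc x) with suc (suc x) <φ? suc ⌊ suc x /φ⌋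
  ... | yes _ = >φ-mono (n≤1+n (suc x)) ≤-refl (lower x)
  ... | no ¬lt with <φ⊎>φ {suc (suc x)} {suc ⌊ suc x /φ⌋} (s≤s z≤n)
  ...   | inj₁ lt = contradiction lt ¬lt
  ...   | inj₂ gt = gt

/φ-least : x <φ suc m → ⌊ x /φ⌋ ≤ m
/φ-least {zero} _ = z≤n
/φ-least {suc x} {m} lt with ⌊ suc x /φ⌋ ≤? m
... | yes le = le
... | no nle = contradiction (>φ-mono ≤-refl (≰⇒> nle) (/φ-lower (s≤s z≤n))) (<φ-asym lt)

/φ-greatest : x >φ m → m ≤ ⌊ x /φ⌋
/φ-greatest {x} {m} gt with m ≤? ⌊ x /φ⌋
... | yes le = le
... | no nle = contradiction gt (<φ-asym (<φ-mono ≤-refl (≰⇒> nle) (/φ-upper x)))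

/φ-+-≤ : ∀ x y → ⌊ x + y /φ⌋ ≤ suc (⌊ x /φ⌋ + ⌊ y /φ⌋)
/φ-+-≤ x y = /φ-least (subst (x + y <φ_) (cong suc (+-suc ⌊ x /φ⌋ ⌊ y /φ⌋)) (<φ-+ (/φ-upper x) (/φ-upper y)))

/φ-+-≥ : ∀ x y → ⌊ x /φ⌋ + ⌊ y /φ⌋ ≤ ⌊ x + y /φ⌋
/φ-+-≥ zero y = ≤-refl
/φ-+-≥ (suc x) zero = ≤-reflexive (trans (+-identityʳ _) (cong ⌊_/φ⌋ (sym (+-identityʳ (suc x)))))
/φ-+-≥ (suc x) (suc y) = /φ-greatest (>φ-+ (/φ-lower (s≤s z≤n)) (/φ-lower (s≤s z≤n)))

/φ-mono : ∀ x y → ⌊ x /φ⌋ ≤ ⌊ x + y /φ⌋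
/φ-mono x y = ≤-trans (m≤m+n ⌊ x /φ⌋ ⌊ y /φ⌋) (/φ-+-≥ x y)

/φ-escapes : ∀ p g → 1 ≤ p → ∃[ K ] (⌊ K * p /φ⌋ ≤ K * g → K * g ≤ suc ⌊ K * p /φ⌋ → ⊥)
/φ-escapes p g 1≤p with <φ⊎>φ {p} {g} 1≤p
... | inj₂ p>φg = K , λ lo _ → <φ-asym (<φ-mono ≤-refl (s≤s lo) (/φ-upper (K * p))) (>φ-scale p g K ≤-refl p>φg)
  where
  K : ℕ
  K = p + 2 * g + 2
... | inj₁ p<φg = K , below
  where
  K : ℕ
  K = p + 2 * g + 2
  1≤K : 1 ≤ K
  1≤K = ≤-trans 1≤p (≤-trans (m≤m+n p (2 * g)) (m≤m+n (p + 2 * g) 2))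
  1≤Kp : 1 ≤ K * p
  1≤Kp = *-mono-≤ 1≤K 1≤p
  Kg≢0 : K * g ≢ 0
  Kg≢0 Kg≡0 with m*n≡0⇒m≡0∨n≡0 K Kg≡0
  ... | inj₁ K≡0 = contradiction (subst (1 ≤_) K≡0 1≤K) λ ()
  ... | inj₂ g≡0 = ¬<φ0 (subst (p <φ_) g≡0 p<φg)
  below : ⌊ K * p /φ⌋ ≤ K * g → K * g ≤ suc ⌊ K * p /φ⌋ → ⊥
  below _ hi with K * g in Kg≡
  ... | zero  = Kg≢0 Kg≡
  ... | suc q = <φ-asym (<φ-scale p g K q ≤-refl p<φg Kg≡) (>φ-mono ≤-refl (s≤s⁻¹ hi) (/φ-lower 1≤Kp))

-- Factors of infinite words

Agree : Word A → ℕ → ℕ → ℕ → Set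
Agree x i j n = ∀ r → r < n → x (i + r) ≡ x (j + r)

applyUpTo-cong : ∀ (f g : ℕ → A) n → (∀ r → r < n → f r ≡ g r) → applyUpTo f n ≡ applyUpTo g n
applyUpTo-cong f g zero    f≗g = refl
applyUpTo-cong f g (suc n) f≗g = cong₂ _∷_ (f≗g 0 z<s) (applyUpTo-cong (f ∘ suc) (g ∘ suc) n (λ r r<n → f≗g (suc r) (s<s r<n)))

applyUpTo-injective : ∀ (f g : ℕ → A) n → applyUpTo f n ≡ applyUpTo g n → ∀ r → r < n → f r ≡ g r
applyUpTo-injective f g (suc n) eq zero    _         = proj₁ (∷-injective eq)
applyUpTo-injective f g (suc n) eq (suc r) (s<s r<n) = applyUpTo-injective (f ∘ suc) (g ∘ suc) n (proj₂ (∷-injective eq)) r r<n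

factorAt-≡⇒Agree : ∀ (x : Word A) i j n → factorAt x i n ≡ factorAt x j n → Agree x i j n
factorAt-≡⇒Agree x i j = applyUpTo-injective (λ r → x (i + r)) (λ r → x (j + r))

Agree⇒factorAt-≡ : ∀ (x : Word A) i j n → Agree x i j n → factorAt x i n ≡ factorAt x j n
Agree⇒factorAt-≡ x i j = applyUpTo-cong (λ r → x (i + r)) (λ r → x (j + r))

Agree-sym : ∀ {x : Word A} → Agree x i j n → Agree x j i n
Agree-sym agree r r<n = sym (agree r r<n)

Agree-trans : ∀ {x : Word A} {k} → Agree x i j n → Agree x j k n → Agree x i k n
Agree-trans agree agree′ r r<n = trans (agree r r<n) (agree′ r r<n)

Agree-≤ : ∀ {x : Word A} {m} → m ≤ n → Agree x i j n → Agree x i j m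
Agree-≤ m≤n agree r r<m = agree r (<-≤-trans r<m m≤n)

Agree-drop : ∀ {x : Word A} k → Agree x i j (k + n) → Agree x (i + k) (j + k) n
Agree-drop {i = i} {j = j} {x = x} k agree r r<n = trans (cong x (+-assoc i k r))
  (trans (agree (k + r) (+-monoʳ-< k r<n)) (cong x (sym (+-assoc j k r))))

Extends : Word A → ℕ → List A → A → Set
Extends x n u a = ∃[ i ] factorAt x i n ≡ u × x (i + n) ≡ a

RightSpecial : Word A → ℕ → List A → A → A → Set
RightSpecial x n u a b = Extends x n u a × Extends x n u b

funToFin-injective : ∀ {m n} (f g : Fin n → Fin m) → funToFin f ≡ funToFin g → ∀ r → f r ≡ g r
funToFin-injective {m} {n} f g same r = trans (sym (finToFun-funToFin {n} {m} f r))
  (trans (cong (λ c → finToFun {m} {n} c r) same) (finToFun-funToFin {n} {m} g r))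

repeated-factor : ∀ {m} (x : Word (Fin m)) n → ∃[ i ] ∃[ j ] i < j × Agree x i j n
repeated-factor {m} x n with pigeonhole (n<1+n (m ^ n)) (λ k → funToFin {n} {m} (window (toℕ k)))
  where
  window : ℕ → Fin n → Fin m
  window i r = x (i + toℕ r)
... | k , k′ , k<k′ , same-code = toℕ k , toℕ k′ , k<k′ , λ r r<n →
  subst (λ s → x (toℕ k + s) ≡ x (toℕ k′ + s)) (toℕ-fromℕ< r<n)
    (funToFin-injective (λ s → x (toℕ k + toℕ s)) (λ s → x (toℕ k′ + toℕ s)) same-code (fromℕ< r<n))

Agree-extend : ∀ {x : Word A} → Agree x i j n → x (i + n) ≡ x (j + n) → Agree x i j (suc n)
Agree-extend agree same r r<1+n with m≤n⇒m<n∨m≡n (s≤s⁻¹ r<1+n)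
... | inj₁ r<n  = agree r r<n
... | inj₂ refl = same

rightSpecial-of-≢ : ∀ (x : Word (Fin 2)) → Agree x i j n → x (i + n) ≢ x (j + n) → ∃[ u ] RightSpecial x n u 0F 1F
rightSpecial-of-≢ {i} {j} {n} x agree differ with x (i + n) in xi | x (j + n) in xj
... | 0F | 0F = contradiction refl differ
... | 0F | 1F = factorAt x i n , (i , refl , xi) , (j , sym (Agree⇒factorAt-≡ x i j n agree) , xj)
... | 1F | 0F = factorAt x j n , (j , refl , xj) , (i , Agree⇒factorAt-≡ x i j n agree , xi)
... | 1F | 1F = contradiction refl differ

rightSpecial-or-Agree : ∀ (x : Word (Fin 2)) T → Agree x i j n → (∃[ u ] RightSpecial x n u 0F 1F) ⊎ Agree x i j (T + n)
rightSpecial-or-Agree x zero agree = inj₂ agree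
rightSpecial-or-Agree {i} {j} {n} x (suc T) agree with rightSpecial-or-Agree x T agree
... | inj₁ special = inj₁ special
... | inj₂ agree′ with x (i + (T + n)) ≟ᶠ x (j + (T + n))
...   | yes same   = inj₂ (Agree-extend {x = x} agree′ same)
...   | no  differ = inj₁ (rightSpecial-of-≢ x (Agree-drop {x = x} T agree′)
                       (λ same → differ (trans (cong x (sym (+-assoc i T n))) (trans same (cong x (+-assoc j T n))))))

Agree-cons : ∀ {x : Word A} {m} → x i ≡ x j → Agree x (suc i) (suc j) m → Agree x i j (suc m)
Agree-cons {i = i} {j = j} {x = x} same agree zero    _         = trans (cong x (+-identityʳ i)) (trans same (cong x (sym (+-identityʳ j))))
Agree-cons {i = i} {j = j} {x = x} same agree (suc r) (s<s r<m) = trans (cong x (+-suc i r)) (trans (agree r r<m) (cong x (sym (+-suc j r))))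

nth-++ʳ : ∀ (xs ys : List A) r d → nth (xs ++ ys) (length xs + r) d ≡ nth ys r d
nth-++ʳ []       ys r d = refl
nth-++ʳ (x ∷ xs) ys r d = nth-++ʳ xs ys r d

nth-++ˡ : ∀ (xs ys : List A) {r} d → r < length xs → nth (xs ++ ys) r d ≡ nth xs r d
nth-++ˡ (x ∷ xs) ys {zero}  d _         = refl
nth-++ˡ (x ∷ xs) ys {suc r} d (s<s r<n) = nth-++ˡ xs ys d r<n

nth-replicate : ∀ n (a : A) {r} d → r < n → nth (replicate n a) r d ≡ a
nth-replicate (suc n) a {zero}  d _         = refl
nth-replicate (suc n) a {suc r} d (s<s r<n) = nth-replicate n a d r<n

applyUpTo-+ : ∀ (f : ℕ → List A) N k → applyUpTo f (N + k) ≡ applyUpTo f N ++ applyUpTo (λ j → f (N + j)) k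
applyUpTo-+ f zero    k = refl
applyUpTo-+ f (suc N) k = cong (f 0 ∷_) (applyUpTo-+ (f ∘ suc) N k)

concat-applyUpTo-suc : ∀ (B : ℕ → List A) N → concat (applyUpTo B (suc N)) ≡ concat (applyUpTo B N) ++ B N
concat-applyUpTo-suc B N = trans (cong concat (sym (applyUpTo-∷ʳ B N)))
  (trans (sym (concat-++ (applyUpTo B N) [ B N ])) (cong (concat (applyUpTo B N) ++_) (++-identityʳ (B N))))

-- The word B 0 ++ B 1 ++ ⋯, read as Defs reads F and S^M: position i is looked up in the first
-- i + 1 blocks, which reach past it when all blocks are nonempty.
blockWord : (ℕ → List A) → A → Word A
blockWord B d i = nth (concat (applyUpTo B (suc i))) i d

blockStart : (ℕ → List A) → ℕ → ℕ
blockStart B N = length (concat (applyUpTo B N))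

blockStart-suc : ∀ (B : ℕ → List A) N → blockStart B (suc N) ≡ blockStart B N + length (B N)
blockStart-suc B N = trans (cong length (concat-applyUpTo-suc B N)) (length-++ (concat (applyUpTo B N)))

blockStart-≥ : ∀ (B : ℕ → List A) → (∀ j → 1 ≤ length (B j)) → ∀ N → N ≤ blockStart B N
blockStart-≥ B nonempty zero    = z≤n
blockStart-≥ B nonempty (suc N) = subst (suc N ≤_) (sym (blockStart-suc B N))
  (subst (_≤ blockStart B N + length (B N)) (+-comm N 1) (+-mono-≤ (blockStart-≥ B nonempty N) (nonempty N)))

blockWord-at : ∀ (B : ℕ → List A) d → (∀ j → 1 ≤ length (B j)) → ∀ N {r} → r < length (B N) →
               blockWord B d (blockStart B N + r) ≡ nth (B N) r d
blockWord-at {A = A} B d nonempty N {r} r<len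
  with m≤n⇒∃[o]m+o≡n (s≤s (≤-trans (blockStart-≥ B nonempty N) (m≤m+n (blockStart B N) r)))
... | k , N+1+k≡ = begin
  nth (concat (applyUpTo B (suc pos))) pos d                ≡⟨ cong (λ n → nth (concat (applyUpTo B n)) pos d) (sym N+1+k≡) ⟩
  nth (concat (applyUpTo B (suc N + k))) pos d              ≡⟨ cong (λ bs → nth (concat bs) pos d) (applyUpTo-+ B (suc N) k) ⟩
  nth (concat (applyUpTo B (suc N) ++ rest)) pos d          ≡⟨ cong (λ w → nth w pos d) (sym (concat-++ (applyUpTo B (suc N)) rest)) ⟩
  nth (concat (applyUpTo B (suc N)) ++ concat rest) pos d   ≡⟨ cong (λ w → nth (w ++ concat rest) pos d) (concat-applyUpTo-suc B N) ⟩
  nth ((concat (applyUpTo B N) ++ B N) ++ concat rest) pos d ≡⟨ cong (λ w → nth w pos d) (++-assoc (concat (applyUpTo B N)) (B N) (concat rest)) ⟩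
  nth (concat (applyUpTo B N) ++ (B N ++ concat rest)) pos d ≡⟨ nth-++ʳ (concat (applyUpTo B N)) _ r d ⟩
  nth (B N ++ concat rest) r d                              ≡⟨ nth-++ˡ (B N) (concat rest) d r<len ⟩
  nth (B N) r d                                             ∎
  where
  open ≡-Reasoning
  pos : ℕ
  pos = blockStart B N + r
  rest : List (List A)
  rest = applyUpTo (λ j → B (suc N + j)) k

IsFactor-∷ʳ⇔ : ∀ (x : Word A) u a → IsFactor x (u ++ [ a ]) ⇔ Extends x (length u) u a
IsFactor-∷ʳ⇔ x u a = mk⇔
  (λ (i , f) → i , ∷ʳ-injective (factorAt x i (length u)) u (trans (sym (factorAt-suc i)) (trans (cong (factorAt x i) (sym length-∷ʳ)) f)))
  (λ (i , f , e) → i , trans (cong (factorAt x i) length-∷ʳ) (trans (factorAt-suc i) (cong₂ (λ v c → v ++ [ c ]) f e)))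
  where
  length-∷ʳ : length (u ++ [ a ]) ≡ suc (length u)
  length-∷ʳ = trans (length-++ u) (+-comm (length u) 1)
  factorAt-suc : ∀ i → factorAt x i (suc (length u)) ≡ factorAt x i (length u) ++ [ x (i + length u) ]
  factorAt-suc i = sym (applyUpTo-∷ʳ (λ r → x (i + r)) (length u))

Edge⇔ : ∀ (x : Word A) b v w → Edge x (b ∷ v) w ⇔ (∃[ a ] w ≡ v ++ [ a ] × Extends x (suc (length v)) (b ∷ v) a)
Edge⇔ x b v w = mk⇔
  (λ { (_ , _ , a , refl , w≡ , factor) → a , w≡ , to (IsFactor-∷ʳ⇔ x (b ∷ v) a) factor })
  (λ (a , w≡ , extends) → b , v , a , refl , w≡ , from (IsFactor-∷ʳ⇔ x (b ∷ v) a) extends)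

outDegree-1 : ∀ (x : Word A) b v c → Extends x (suc (length v)) (b ∷ v) c →
              (∀ a → Extends x (suc (length v)) (b ∷ v) a → a ≡ c) → HasOutDegree x (b ∷ v) 1
outDegree-1 x b v c extends only = (v ++ [ c ]) ∷ [] , refl , [] ∷ [] , λ w → mk⇔
  (λ { (here w≡) → from (Edge⇔ x b v w) (c , w≡ , extends) ; (there ()) })
  (λ edge → let (a , w≡ , extends′) = to (Edge⇔ x b v w) edge in here (trans w≡ (cong (λ a → v ++ [ a ]) (only a extends′))))

outDegree-2 : ∀ (x : Word A) b v {a₁ a₂} → a₁ ≢ a₂ → RightSpecial x (suc (length v)) (b ∷ v) a₁ a₂ →
              (∀ a → Extends x (suc (length v)) (b ∷ v) a → a ≡ a₁ ⊎ a ≡ a₂) → HasOutDegree x (b ∷ v) 2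
outDegree-2 x b v {a₁} {a₂} a₁≢a₂ (extends₁ , extends₂) only =
  (v ++ [ a₁ ]) ∷ (v ++ [ a₂ ]) ∷ [] , refl , ((a₁≢a₂ ∘ ∷ʳ-injectiveʳ v v) ∷ []) ∷ [] ∷ [] , λ w → mk⇔
  (λ { (here w≡)         → from (Edge⇔ x b v w) (a₁ , w≡ , extends₁)
      ; (there (here w≡)) → from (Edge⇔ x b v w) (a₂ , w≡ , extends₂)
      ; (there (there ())) })
  (λ edge → let (a , w≡ , extends) = to (Edge⇔ x b v w) edge in one-of a w≡ (only a extends))
  where
  one-of : ∀ {w} a → w ≡ v ++ [ a ] → a ≡ a₁ ⊎ a ≡ a₂ → w ∈ (v ++ [ a₁ ]) ∷ (v ++ [ a₂ ]) ∷ []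
  one-of a w≡ (inj₁ refl) = here w≡
  one-of a w≡ (inj₂ refl) = there (here w≡)

Extends⇒IsVertex : ∀ {x : Word A} {n u a} → Extends x n u a → IsVertex x n u
Extends⇒IsVertex {x = x} {n} {u} (i , factor , _) = (i , trans (cong (factorAt x i) length-u) factor) , length-u
  where
  length-u : length u ≡ n
  length-u = trans (cong length (sym factor)) (length-applyUpTo (λ r → x (i + r)) n)

-- The Sturmian word of slope 1/φ

-- sturm t is 1 exactly when ⌊(t + 2)/φ⌋ = ⌊(t + 1)/φ⌋.
sturm : Word (Fin 2)
sturm t = if does (suc (suc t) <φ? suc ⌊ suc t /φ⌋) then 1F else 0F

sturm≡1F : ∀ t → suc (suc t) <φ suc ⌊ suc t /φ⌋ → sturm t ≡ 1F
sturm≡1F t below with suc (suc t) <φ? suc ⌊ suc t /φ⌋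
... | yes _ = refl
... | no ¬below = contradiction below ¬below

sturm≡0F : ∀ t → ¬ suc (suc t) <φ suc ⌊ suc t /φ⌋ → sturm t ≡ 0F
sturm≡0F t ¬below with suc (suc t) <φ? suc ⌊ suc t /φ⌋
... | yes below = contradiction below ¬below
... | no _ = refl

zeros : Fin 2 → ℕ
zeros 0F = 1
zeros 1F = 0

zerosBefore : ℕ → ℕ
zerosBefore t = ⌊ suc t /φ⌋

zerosBefore-suc : ∀ t → zerosBefore (suc t) ≡ zerosBefore t + zeros (sturm t)
zerosBefore-suc t with suc (suc t) <φ? suc ⌊ suc t /φ⌋
... | yes _ = sym (+-identityʳ _)
... | no _  = +-comm 1 _

zerosBefore-Agree : ∀ p q m → Agree sturm p q m → zerosBefore (p + m) + zerosBefore q ≡ zerosBefore (q + m) + zerosBefore p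
zerosBefore-Agree p q zero _ = begin
  zerosBefore (p + 0) + zerosBefore q ≡⟨ cong (λ a → zerosBefore a + zerosBefore q) (+-identityʳ p) ⟩
  zerosBefore p + zerosBefore q       ≡⟨ +-comm (zerosBefore p) (zerosBefore q) ⟩
  zerosBefore q + zerosBefore p       ≡⟨ cong (λ a → zerosBefore a + zerosBefore p) (sym (+-identityʳ q)) ⟩
  zerosBefore (q + 0) + zerosBefore p ∎
  where open ≡-Reasoning
zerosBefore-Agree p q (suc m) agree = begin
  zerosBefore (p + suc m) + zerosBefore q                         ≡⟨ cong (λ a → zerosBefore a + zerosBefore q) (+-suc p m) ⟩
  zerosBefore (suc (p + m)) + zerosBefore q                       ≡⟨ cong (_+ zerosBefore q) (zerosBefore-suc (p + m)) ⟩
  zerosBefore (p + m) + zeros (sturm (p + m)) + zerosBefore q     ≡⟨ swap (zerosBefore (p + m)) _ (zerosBefore q) ⟩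
  (zerosBefore (p + m) + zerosBefore q) + zeros (sturm (p + m))   ≡⟨ cong₂ _+_ (zerosBefore-Agree p q m (Agree-≤ {x = sturm} (n≤1+n m) agree)) (cong zeros (agree m ≤-refl)) ⟩
  (zerosBefore (q + m) + zerosBefore p) + zeros (sturm (q + m))   ≡⟨ swap (zerosBefore (q + m)) (zerosBefore p) _ ⟩
  zerosBefore (q + m) + zeros (sturm (q + m)) + zerosBefore p     ≡⟨ cong (_+ zerosBefore p) (sym (zerosBefore-suc (q + m))) ⟩
  zerosBefore (suc (q + m)) + zerosBefore p                       ≡⟨ cong (λ a → zerosBefore a + zerosBefore p) (sym (+-suc q m)) ⟩
  zerosBefore (q + suc m) + zerosBefore p                         ∎
  where
  open ≡-Reasoning
  swap : ∀ a b c → a + b + c ≡ a + c + b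
  swap = solve-∀

zerosBefore-balanced : ∀ i j L → zerosBefore (i + L) + zerosBefore j ≤ suc (zerosBefore (j + L) + zerosBefore i)
zerosBefore-balanced i j L = begin
  ⌊ suc i + L /φ⌋ + zerosBefore j                     ≤⟨ +-monoˡ-≤ (zerosBefore j) (/φ-+-≤ (suc i) L) ⟩
  suc (zerosBefore i + ⌊ L /φ⌋) + zerosBefore j       ≡⟨ cong suc (shuffle (zerosBefore i) ⌊ L /φ⌋ (zerosBefore j)) ⟩
  suc ((zerosBefore j + ⌊ L /φ⌋) + zerosBefore i)     ≤⟨ s≤s (+-monoˡ-≤ (zerosBefore i) (/φ-+-≥ (suc j) L)) ⟩
  suc (⌊ suc j + L /φ⌋ + zerosBefore i)               ∎
  where
  open ≤-Reasoning
  shuffle : ∀ a l b → a + l + b ≡ b + l + a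
  shuffle = solve-∀

-- The factors 0w0 and 1w1 cannot both occur: their numbers of zeros differ by two.
sturm-balanced : ∀ p q m → Agree sturm (suc p) (suc q) m → sturm p ≡ 0F → sturm (suc p + m) ≡ 0F →
                 sturm q ≡ 1F → sturm (suc q + m) ≡ 1F → ⊥
sturm-balanced p q m agree p0 pm0 q1 qm1 = 1+n≰n (s≤s⁻¹ (subst₂ _≤_ lhs rhs (zerosBefore-balanced p q (suc (suc m)))))
  where
  P Q P′ Q′ : ℕ
  P = zerosBefore p
  Q = zerosBefore q
  P′ = zerosBefore (suc p + m)
  Q′ = zerosBefore (suc q + m)
  +2 : ∀ a → a + suc (suc m) ≡ suc (suc a + m)
  +2 a = trans (+-suc a (suc m)) (cong suc (+-suc a m))
  step : ∀ a {c} → sturm a ≡ c → zerosBefore (suc a) ≡ zerosBefore a + zeros c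
  step a eq = trans (zerosBefore-suc a) (cong (λ c → zerosBefore a + zeros c) eq)
  middle : P′ + (Q + 0) ≡ Q′ + (P + 1)
  middle = subst₂ (λ b a → P′ + b ≡ Q′ + a) (step q q1) (step p p0) (zerosBefore-Agree (suc p) (suc q) m agree)
  lhs : zerosBefore (p + suc (suc m)) + Q ≡ suc (suc (Q′ + P))
  lhs = begin
    zerosBefore (p + suc (suc m)) + Q     ≡⟨ cong (λ a → zerosBefore a + Q) (+2 p) ⟩
    zerosBefore (suc (suc p + m)) + Q     ≡⟨ cong (_+ Q) (step (suc p + m) pm0) ⟩
    P′ + 1 + Q                         ≡⟨ arith₁ P′ Q ⟩
    P′ + (Q + 0) + 1                   ≡⟨ cong (_+ 1) middle ⟩
    Q′ + (P + 1) + 1                   ≡⟨ arith₂ Q′ P ⟩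
    suc (suc (Q′ + P))                 ∎
    where
    open ≡-Reasoning
    arith₁ : ∀ x b → x + 1 + b ≡ x + (b + 0) + 1
    arith₁ = solve-∀
    arith₂ : ∀ y a → y + (a + 1) + 1 ≡ suc (suc (y + a))
    arith₂ = solve-∀
  rhs : suc (zerosBefore (q + suc (suc m)) + P) ≡ suc (Q′ + P)
  rhs = cong (λ a → suc (a + P)) (trans (cong zerosBefore (+2 q)) (trans (step (suc q + m) qm1) (+-identityʳ Q′)))

sturm-rightSpecial-unique : ∀ n {u v} → RightSpecial sturm n u 0F 1F → RightSpecial sturm n v 0F 1F → u ≡ v
sturm-rightSpecial-unique n ((i₀ , u≡ , i₀→0) , (i₁ , u≡′ , i₁→1)) ((j₀ , v≡ , j₀→0) , (j₁ , v≡′ , j₁→1)) =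
  trans (sym u≡) (trans (Agree⇒factorAt-≡ sturm i₀ j₀ n
    (subst₂ (λ a b → Agree sturm a b n) (+-identityʳ i₀) (+-identityʳ j₀) (suffixes n 0 refl))) v≡)
  where
  u-twice : Agree sturm i₀ i₁ n
  u-twice = factorAt-≡⇒Agree sturm i₀ i₁ n (trans u≡ (sym u≡′))
  v-twice : Agree sturm j₀ j₁ n
  v-twice = factorAt-≡⇒Agree sturm j₀ j₁ n (trans v≡ (sym v≡′))
  -- The windows agree on every suffix: a first disagreement, read from the right, would exhibit
  -- 0w0 and 1w1 with w the common part after it.
  suffixes : ∀ m r → r + m ≡ n → Agree sturm (i₀ + r) (j₀ + r) m
  suffixes zero    r _        = λ _ ()
  suffixes (suc m) r r+1+m≡n = Agree-cons {x = sturm} letter after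
    where
    r<n : r < n
    r<n = subst (r <_) r+1+m≡n (m<m+n r z<s)
    behind : ∀ {a b} → Agree sturm a b n → Agree sturm (suc (a + r)) (suc (b + r)) m
    behind {a} {b} agree = subst₂ (λ a′ b′ → Agree sturm a′ b′ m) (+-suc a r) (+-suc b r)
      (Agree-drop {x = sturm} (suc r) (subst (Agree sturm a b) (trans (sym r+1+m≡n) (+-suc r m)) agree))
    at-end : ∀ a {c} → sturm (a + n) ≡ c → sturm (suc (a + r) + m) ≡ c
    at-end a = trans (cong sturm (trans (sym (+-suc (a + r) m)) (trans (+-assoc a r (suc m)) (cong (a +_) r+1+m≡n))))
    after : Agree sturm (suc (i₀ + r)) (suc (j₀ + r)) m
    after = subst₂ (λ a b → Agree sturm a b m) (+-suc i₀ r) (+-suc j₀ r) (suffixes m (suc r) (trans (sym (+-suc r m)) r+1+m≡n))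
    letter : sturm (i₀ + r) ≡ sturm (j₀ + r)
    letter with sturm (i₀ + r) in u₀ | sturm (j₀ + r) in v₀
    ... | 0F | 0F = refl
    ... | 1F | 1F = refl
    ... | 0F | 1F = ⊥-elim (sturm-balanced (i₀ + r) (j₁ + r) m (Agree-trans {x = sturm} after (behind v-twice))
                      u₀ (at-end i₀ i₀→0) (trans (sym (v-twice r r<n)) v₀) (at-end j₁ j₁→1))
    ... | 1F | 0F = ⊥-elim (sturm-balanced (j₀ + r) (i₁ + r) m (Agree-trans {x = sturm} (Agree-sym {x = sturm} after) (behind u-twice))
                      v₀ (at-end j₀ j₀→0) (trans (sym (u-twice r r<n)) u₀) (at-end i₁ i₁→1))

zerosBefore-periodic : ∀ i p g T → Agree sturm i (i + p) T → zerosBefore (i + p) ≡ zerosBefore i + g →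
                       ∀ k → k * p ≤ T → zerosBefore (i + k * p) ≡ zerosBefore i + k * g
zerosBefore-periodic i p g T periodic one-period zero _ = trans (cong zerosBefore (+-identityʳ i)) (sym (+-identityʳ _))
zerosBefore-periodic i p g T periodic one-period (suc k) k+1·p≤T = +-cancelʳ-≡ (zerosBefore i) _ _ (begin
  zerosBefore (i + (p + k * p)) + zerosBefore i   ≡⟨ cong (λ a → zerosBefore a + zerosBefore i) (sym (+-assoc i p (k * p))) ⟩
  zerosBefore (i + p + k * p) + zerosBefore i     ≡⟨ sym (zerosBefore-Agree i (i + p) (k * p) (Agree-≤ {x = sturm} k·p≤T periodic)) ⟩
  zerosBefore (i + k * p) + zerosBefore (i + p)   ≡⟨ cong₂ _+_ (zerosBefore-periodic i p g T periodic one-period k k·p≤T) one-period ⟩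
  zerosBefore i + k * g + (zerosBefore i + g)     ≡⟨ arith (zerosBefore i) k g ⟩
  zerosBefore i + (g + k * g) + zerosBefore i     ∎)
  where
  open ≡-Reasoning
  k·p≤T : k * p ≤ T
  k·p≤T = ≤-trans (m≤n+m (k * p) p) k+1·p≤T
  arith : ∀ z k g → z + k * g + (z + g) ≡ z + (g + k * g) + z
  arith = solve-∀

-- Periodicity with period p would make zerosBefore, i.e. ⌊_/φ⌋, grow with the rational slope g/p.
sturm-aperiodic : ∀ i p → 1 ≤ p → ∃[ T ] ¬ Agree sturm i (i + p) T
sturm-aperiodic i p 1≤p = aperiodic (/φ-escapes p g 1≤p)
  where
  g : ℕ
  g = zerosBefore (i + p) ∸ zerosBefore i
  aperiodic : ∃[ K ] (⌊ K * p /φ⌋ ≤ K * g → K * g ≤ suc ⌊ K * p /φ⌋ → ⊥) → ∃[ T ] ¬ Agree sturm i (i + p) T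
  aperiodic (K , escape) = K * p , λ periodic → escape (lo periodic) (hi periodic)
    where
    period : Agree sturm i (i + p) (K * p) → zerosBefore (i + K * p) ≡ zerosBefore i + K * g
    period periodic = zerosBefore-periodic i p g (K * p) periodic (sym (m+[n∸m]≡n (/φ-mono (suc i) p))) K ≤-refl
    lo : Agree sturm i (i + p) (K * p) → ⌊ K * p /φ⌋ ≤ K * g
    lo periodic = +-cancelˡ-≤ (zerosBefore i) ⌊ K * p /φ⌋ (K * g) (≤-trans (/φ-+-≥ (suc i) (K * p)) (≤-reflexive (period periodic)))
    hi : Agree sturm i (i + p) (K * p) → K * g ≤ suc ⌊ K * p /φ⌋
    hi periodic = +-cancelˡ-≤ (zerosBefore i) (K * g) (suc ⌊ K * p /φ⌋) (≤-trans (≤-reflexive (sym (period periodic)))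
      (≤-trans (/φ-+-≤ (suc i) (K * p)) (≤-reflexive (sym (+-suc (zerosBefore i) ⌊ K * p /φ⌋)))))

sturm-rightSpecial : ∀ n → ∃[ u ] RightSpecial sturm n u 0F 1F
sturm-rightSpecial n with repeated-factor sturm n
... | i , j , i<j , agree = extend (sturm-aperiodic i (j ∸ i) (m<n⇒0<n∸m i<j))
  where
  agree′ : Agree sturm i (i + (j ∸ i)) n
  agree′ = subst (λ j → Agree sturm i j n) (sym (m+[n∸m]≡n (<⇒≤ i<j))) agree
  extend : ∃[ T ] ¬ Agree sturm i (i + (j ∸ i)) T → ∃[ u ] RightSpecial sturm n u 0F 1F
  extend (T , aperiodic) with rightSpecial-or-Agree sturm T agree′
  ... | inj₁ special = special
  ... | inj₂ long    = contradiction (Agree-≤ {x = sturm} (m≤m+n T n) long) aperiodic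

-- The structure of F and S^M

count : (ℕ → Bool) → ℕ → ℕ
count P L = sum (applyUpTo (λ i → if P i then 1 else 0) L)

<-count⇔ : ∀ (P : ℕ → Bool) → (∀ k → T (P (suc k)) → T (P k)) → ∀ L x → x < count P L ⇔ (x < L × T (P x))
<-count⇔ P closed zero x = mk⇔ (λ ()) (λ ())
<-count⇔ P closed (suc L) x with P 0 in P0
... | false = mk⇔ (λ x<c → contradiction (from-0 (suc x) (proj₂ (to IH x<c))) (subst T P0))
                  (λ (_ , t) → contradiction (from-0 x t) (subst T P0))
  where
  IH : x < count (P ∘ suc) L ⇔ (x < L × T (P (suc x)))
  IH = <-count⇔ (P ∘ suc) (closed ∘ suc) L x
  from-0 : ∀ x → T (P x) → T (P 0)
  from-0 zero t = t
  from-0 (suc x) t = from-0 x (closed x t)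
... | true = mk⇔ (forward x) (backward x)
  where
  IH : ∀ x → x < count (P ∘ suc) L ⇔ (x < L × T (P (suc x)))
  IH = <-count⇔ (P ∘ suc) (closed ∘ suc) L
  forward : ∀ x → x < suc (count (P ∘ suc) L) → x < suc L × T (P x)
  forward zero    _         = z<s , subst T (sym P0) tt
  forward (suc x) (s<s x<c) = s<s (proj₁ (to (IH x) x<c)) , proj₂ (to (IH x) x<c)
  backward : ∀ x → x < suc L × T (P x) → x < suc (count (P ∘ suc) L)
  backward zero    _               = z<s
  backward (suc x) (s<s x<L , t)   = s<s (from (IH x) (x<L , t))

T-belowMulφ⇔ : 1 ≤ k → T (belowMulφ k m) ⇔ k <φ m
T-belowMulφ⇔ {k} {m} 1≤k = mk⇔ below (λ (mk<φ lt) → from T-∨ (inj₂ (<⇒<ᵇ lt)))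
  where
  below : T (belowMulφ k m) → k <φ m
  below t with to T-∨ t
  ... | inj₁ 2k≤m = ≤⇒<φ k≤m (≤-trans 1≤k k≤m)
    where
    k≤m : k ≤ m
    k≤m = ≤-trans (m≤m+n k (k + 0)) (≤ᵇ⇒≤ (2 * k) m 2k≤m)
  ... | inj₂ lt = mk<φ (<ᵇ⇒< _ _ lt)

floorMulφ-spec : ∀ x m → suc x ≤ floorMulφ m ⇔ suc x <φ m
floorMulφ-spec x m = mk⇔
  (λ x<⌊mφ⌋ → to (T-belowMulφ⇔ (s≤s z≤n)) (proj₂ (to counted x<⌊mφ⌋)))
  (λ 1+x<φm → from counted (<φ⇒≤2* 1+x<φm , from (T-belowMulφ⇔ (s≤s z≤n)) 1+x<φm))
  where
  P : ℕ → Bool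
  P i = belowMulφ (suc i) m
  closed : ∀ k → T (P (suc k)) → T (P k)
  closed k t = from (T-belowMulφ⇔ {m = m} (s≤s z≤n)) (<φ-mono (n≤1+n (suc k)) ≤-refl (to (T-belowMulφ⇔ {m = m} (s≤s z≤n)) t))
  counted : x < count P (2 * m) ⇔ (x < 2 * m × T (P x))
  counted = <-count⇔ P closed (2 * m) x

floorMulφ-suc-≥ : ∀ N → suc (floorMulφ N) ≤ floorMulφ (suc N)
floorMulφ-suc-≥ N with floorMulφ N in eq
... | zero  = from (floorMulφ-spec 0 (suc N)) (≤⇒<φ (s≤s z≤n) (s≤s z≤n))
... | suc y = from (floorMulφ-spec (suc y) (suc N)) (subst₂ _<φ_ (+-comm (suc y) 1) (+-comm N 1)
                (<φ-+ (to (floorMulφ-spec y N) (≤-reflexive (sym eq))) (mk<φ {1} {1} (s≤s (s≤s z≤n)))))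

floorMulφ-suc-≤ : ∀ N → floorMulφ (suc N) ≤ suc (suc (floorMulφ N))
floorMulφ-suc-≤ N with floorMulφ (suc N) ≤? suc (suc (floorMulφ N))
... | yes le = le
... | no gt = ⊥-elim (<φ-asym (to (floorMulφ-spec (suc (suc (floorMulφ N))) (suc N)) (≰⇒> gt))
  (subst₂ _>φ_ (+-comm (suc (floorMulφ N)) 2) (+-comm N 1) (>φ-+ above (mk>φ {2} {1} (s≤s (s≤s (s≤s (s≤s (s≤s (s≤s z≤n))))))))))
  where
  above : suc (floorMulφ N) >φ N
  above with <φ⊎>φ {suc (floorMulφ N)} {N} (s≤s z≤n)
  ... | inj₁ lt = contradiction (from (floorMulφ-spec (floorMulφ N) N) lt) (<-irrefl refl)
  ... | inj₂ gt = gt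

floorMulφ-step : ∀ N → floorMulφ (suc N) ≡ suc (floorMulφ N) ⊎ floorMulφ (suc N) ≡ suc (suc (floorMulφ N))
floorMulφ-step N with m≤n⇒m<n∨m≡n (floorMulφ-suc-≤ N)
... | inj₁ lt = inj₁ (≤-antisym (s≤s⁻¹ lt) (floorMulφ-suc-≥ N))
... | inj₂ eq = inj₂ eq

Fblock : ℕ → List (Fin 2)
Fblock j = cutBlock floorMulφ (suc j)

gap : ℕ → ℕ
gap N = floorMulφ (suc N) ∸ floorMulφ N

length-Fblock : ∀ N → length (Fblock N) ≡ gap N + 1
length-Fblock N = trans (length-++ (replicate (gap N) 0F)) (cong (_+ 1) (length-replicate (gap N)))

blockStart-Fblock : ∀ N → blockStart Fblock N ≡ floorMulφ N + N
blockStart-Fblock zero    = refl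
blockStart-Fblock (suc N) = begin
  blockStart Fblock (suc N)                  ≡⟨ blockStart-suc Fblock N ⟩
  blockStart Fblock N + length (Fblock N)    ≡⟨ cong₂ _+_ (blockStart-Fblock N) (length-Fblock N) ⟩
  floorMulφ N + N + (gap N + 1)              ≡⟨ arith (floorMulφ N) N (gap N) ⟩
  (floorMulφ N + gap N) + suc N              ≡⟨ cong (_+ suc N) (m+[n∸m]≡n (<⇒≤ (floorMulφ-suc-≥ N))) ⟩
  floorMulφ (suc N) + suc N                  ∎
  where
  open ≡-Reasoning
  arith : ∀ a n d → a + n + (d + 1) ≡ (a + d) + suc n
  arith = solve-∀

F-at : ∀ N {r} → r < gap N + 1 → F (floorMulφ N + N + r) ≡ nth (Fblock N) r 0F
F-at N {r} r<len = trans (cong (λ s → F (s + r)) (sym (blockStart-Fblock N)))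
  (blockWord-at Fblock 0F (λ j → subst (1 ≤_) (sym (length-Fblock j)) (m≤n+m 1 (gap j))) N (subst (r <_) (sym (length-Fblock N)) r<len))

F-zeros : ∀ N {r} → r < gap N → F (floorMulφ N + N + r) ≡ 0F
F-zeros N {r} r<gap = trans (F-at N (≤-trans r<gap (m≤m+n (gap N) 1)))
  (trans (nth-++ˡ (replicate (gap N) 0F) [ 1F ] 0F (subst (r <_) (sym (length-replicate (gap N))) r<gap))
    (nth-replicate (gap N) 0F 0F r<gap))

F-one : ∀ N → F (floorMulφ N + N + gap N) ≡ 1F
F-one N = trans (F-at N (subst (gap N <_) (+-comm 1 (gap N)) ≤-refl))
  (trans (cong (λ r → nth (replicate (gap N) 0F ++ [ 1F ]) r 0F) (sym (trans (+-identityʳ _) (length-replicate (gap N)))))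
    (nth-++ʳ (replicate (gap N) 0F) [ 1F ] 0 0F))

SMstart : ℕ → ℕ
SMstart = blockStart SMpiece

SMpiece-00 : ∀ i → F i ≡ 0F → F (suc i) ≡ 0F → SMpiece i ≡ 0F ∷ 2F ∷ []
SMpiece-00 i Fi Fi+1 rewrite Fi | Fi+1 = refl

SMpiece-01 : ∀ i → F i ≡ 0F → F (suc i) ≡ 1F → SMpiece i ≡ 0F ∷ []
SMpiece-01 i Fi Fi+1 rewrite Fi | Fi+1 = refl

SMpiece-1 : ∀ i → F i ≡ 1F → SMpiece i ≡ 1F ∷ []
SMpiece-1 i Fi rewrite Fi = refl

SM-piece : ∀ i {r} → r < length (SMpiece i) → SM (SMstart i + r) ≡ nth (SMpiece i) r 0F
SM-piece = blockWord-at SMpiece 0F (λ _ → s≤s z≤n)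

SM-first : ∀ i {c cs} → SMpiece i ≡ c ∷ cs → SM (SMstart i) ≡ c
SM-first i {c} {cs} piece = trans (cong SM (sym (+-identityʳ (SMstart i))))
  (trans (SM-piece i (subst (λ p → 0 < length p) (sym piece) z<s)) (cong (λ p → nth p 0 0F) piece))

SM-second : ∀ i {c c′ cs} → SMpiece i ≡ c ∷ c′ ∷ cs → SM (suc (SMstart i)) ≡ c′
SM-second i {c} {c′} {cs} piece = trans (cong SM (+-comm 1 (SMstart i)))
  (trans (SM-piece i (subst (λ p → 1 < length p) (sym piece) (s<s z<s))) (cong (λ p → nth p 1 0F) piece))

SMstart-next : ∀ i {cs} → SMpiece i ≡ cs → SMstart (suc i) ≡ length cs + SMstart i
SMstart-next i piece = trans (blockStart-suc SMpiece i) (trans (+-comm (SMstart i) _) (cong (λ p → length p + SMstart i) piece))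

-- The N-th block 0…01 of F (one or two zeros) becomes 01 or 0201 in S^M.
data SMblock (N : ℕ) : Set where
  short : floorMulφ (suc N) ≡ suc (floorMulφ N) →
          SM (2 * floorMulφ N) ≡ 0F → SM (suc (2 * floorMulφ N)) ≡ 1F → SMblock N
  long  : floorMulφ (suc N) ≡ suc (suc (floorMulφ N)) →
          SM (2 * floorMulφ N) ≡ 0F → SM (1 + 2 * floorMulφ N) ≡ 2F →
          SM (2 + 2 * floorMulφ N) ≡ 0F → SM (3 + 2 * floorMulφ N) ≡ 1F → SMblock N

2*-suc : ∀ x → 2 * suc x ≡ suc (suc (2 * x))
2*-suc = solve-∀

SMblock-short : ∀ N → SMstart (floorMulφ N + N) ≡ 2 * floorMulφ N → floorMulφ (suc N) ≡ suc (floorMulφ N) →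
                SMstart (floorMulφ (suc N) + suc N) ≡ 2 * floorMulφ (suc N) × SMblock N
SMblock-short N start G₊≡ = next , short G₊≡ (trans (cong SM (sym start)) (SM-first a₀ piece₀))
                                             (trans (cong SM (sym start₁)) (SM-first (suc a₀) piece₁))
  where
  a₀ : ℕ
  a₀ = floorMulφ N + N
  gap≡ : gap N ≡ 1
  gap≡ = trans (cong (_∸ floorMulφ N) G₊≡) (m+n∸n≡m 1 (floorMulφ N))
  Fa : F a₀ ≡ 0F
  Fa = trans (cong F (sym (+-identityʳ a₀))) (F-zeros N (subst (0 <_) (sym gap≡) z<s))
  Fa+1 : F (suc a₀) ≡ 1F
  Fa+1 = trans (cong F (trans (+-comm 1 a₀) (cong (a₀ +_) (sym gap≡)))) (F-one N)
  piece₀ : SMpiece a₀ ≡ 0F ∷ []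
  piece₀ = SMpiece-01 a₀ Fa Fa+1
  piece₁ : SMpiece (suc a₀) ≡ 1F ∷ []
  piece₁ = SMpiece-1 (suc a₀) Fa+1
  start₁ : SMstart (suc a₀) ≡ suc (2 * floorMulφ N)
  start₁ = trans (SMstart-next a₀ piece₀) (cong suc start)
  next : SMstart (floorMulφ (suc N) + suc N) ≡ 2 * floorMulφ (suc N)
  next = begin
    SMstart (floorMulφ (suc N) + suc N) ≡⟨ cong (λ g → SMstart (g + suc N)) G₊≡ ⟩
    SMstart (suc (floorMulφ N + suc N)) ≡⟨ cong (SMstart ∘ suc) (+-suc (floorMulφ N) N) ⟩
    SMstart (suc (suc a₀))               ≡⟨ SMstart-next (suc a₀) piece₁ ⟩
    suc (SMstart (suc a₀))               ≡⟨ cong suc start₁ ⟩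
    suc (suc (2 * floorMulφ N))         ≡⟨ sym (2*-suc (floorMulφ N)) ⟩
    2 * suc (floorMulφ N)               ≡⟨ cong (2 *_) (sym G₊≡) ⟩
    2 * floorMulφ (suc N)               ∎
    where open ≡-Reasoning
SMblock-long : ∀ N → SMstart (floorMulφ N + N) ≡ 2 * floorMulφ N → floorMulφ (suc N) ≡ suc (suc (floorMulφ N)) →
               SMstart (floorMulφ (suc N) + suc N) ≡ 2 * floorMulφ (suc N) × SMblock N
SMblock-long N start G₊≡ = next , long G₊≡ (trans (cong SM (sym start)) (SM-first a₀ piece₀))
                                           (trans (cong (SM ∘ suc) (sym start)) (SM-second a₀ piece₀))
                                           (trans (cong SM (sym start₁)) (SM-first (suc a₀) piece₁))
                                           (trans (cong SM (sym start₂)) (SM-first (suc (suc a₀)) piece₂))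
  where
  a₀ : ℕ
  a₀ = floorMulφ N + N
  gap≡ : gap N ≡ 2
  gap≡ = trans (cong (_∸ floorMulφ N) G₊≡) (m+n∸n≡m 2 (floorMulφ N))
  Fa : F a₀ ≡ 0F
  Fa = trans (cong F (sym (+-identityʳ a₀))) (F-zeros N (subst (0 <_) (sym gap≡) z<s))
  Fa+1 : F (suc a₀) ≡ 0F
  Fa+1 = trans (cong F (+-comm 1 a₀)) (F-zeros N (subst (1 <_) (sym gap≡) (s<s z<s)))
  Fa+2 : F (suc (suc a₀)) ≡ 1F
  Fa+2 = trans (cong F (trans (+-comm 2 a₀) (cong (a₀ +_) (sym gap≡)))) (F-one N)
  piece₀ : SMpiece a₀ ≡ 0F ∷ 2F ∷ []
  piece₀ = SMpiece-00 a₀ Fa Fa+1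
  piece₁ : SMpiece (suc a₀) ≡ 0F ∷ []
  piece₁ = SMpiece-01 (suc a₀) Fa+1 Fa+2
  piece₂ : SMpiece (suc (suc a₀)) ≡ 1F ∷ []
  piece₂ = SMpiece-1 (suc (suc a₀)) Fa+2
  start₁ : SMstart (suc a₀) ≡ 2 + 2 * floorMulφ N
  start₁ = trans (SMstart-next a₀ piece₀) (cong (2 +_) start)
  start₂ : SMstart (suc (suc a₀)) ≡ 3 + 2 * floorMulφ N
  start₂ = trans (SMstart-next (suc a₀) piece₁) (cong suc start₁)
  next : SMstart (floorMulφ (suc N) + suc N) ≡ 2 * floorMulφ (suc N)
  next = begin
    SMstart (floorMulφ (suc N) + suc N)     ≡⟨ cong (λ g → SMstart (g + suc N)) G₊≡ ⟩
    SMstart (suc (suc (floorMulφ N + suc N))) ≡⟨ cong (SMstart ∘ suc ∘ suc) (+-suc (floorMulφ N) N) ⟩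
    SMstart (suc (suc (suc a₀)))             ≡⟨ SMstart-next (suc (suc a₀)) piece₂ ⟩
    suc (SMstart (suc (suc a₀)))             ≡⟨ cong suc start₂ ⟩
    4 + 2 * floorMulφ N                     ≡⟨ sym (arith (floorMulφ N)) ⟩
    2 * suc (suc (floorMulφ N))             ≡⟨ cong (2 *_) (sym G₊≡) ⟩
    2 * floorMulφ (suc N)                   ∎
    where
    open ≡-Reasoning
    arith : ∀ x → 2 * suc (suc x) ≡ 4 + 2 * x
    arith = solve-∀

SMblock-next : ∀ N → SMstart (floorMulφ N + N) ≡ 2 * floorMulφ N →
               SMstart (floorMulφ (suc N) + suc N) ≡ 2 * floorMulφ (suc N) × SMblock N
SMblock-next N start with floorMulφ-step N
... | inj₁ G₊≡ = SMblock-short N start G₊≡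
... | inj₂ G₊≡ = SMblock-long N start G₊≡

SMstart-block : ∀ N → SMstart (floorMulφ N + N) ≡ 2 * floorMulφ N
SMstart-block zero    = refl
SMstart-block (suc N) = proj₁ (SMblock-next N (SMstart-block N))

SM-block : ∀ N → SMblock N
SM-block N = proj₂ (SMblock-next N (SMstart-block N))

floorMulφ-/φ : ∀ t → floorMulφ ⌊ suc t /φ⌋ ≤ t × t < floorMulφ (suc ⌊ suc t /φ⌋)
floorMulφ-/φ t = G≤t , from (floorMulφ-spec t (suc ⌊ suc t /φ⌋)) (/φ-upper (suc t))
  where
  G≤t : floorMulφ ⌊ suc t /φ⌋ ≤ t
  G≤t with suc t ≤? floorMulφ ⌊ suc t /φ⌋
  ... | yes t<G = ⊥-elim (<φ-asym (to (floorMulφ-spec t ⌊ suc t /φ⌋) t<G) (/φ-lower (s≤s z≤n)))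
  ... | no t≮G  = ≤-pred (≰⇒> t≮G)

-- S^M = 0 a₀ 0 a₁ 0 a₂ ⋯ with aₜ = 1 + sturm t: the letter following the t-th 0 is 2 exactly when
-- t + 1 is still inside the block of F that contains t.
SM-even-odd : ∀ t → SM (2 * t) ≡ 0F × SM (suc (2 * t)) ≡ Fin.suc (sturm t)
SM-even-odd t = letters (SM-block N)
  where
  N : ℕ
  N = ⌊ suc t /φ⌋
  G≤t : floorMulφ N ≤ t
  G≤t = proj₁ (floorMulφ-/φ t)
  t<G₊ : t < floorMulφ (suc N)
  t<G₊ = proj₂ (floorMulφ-/φ t)
  sturm-1 : suc (suc t) ≤ floorMulφ (suc N) → sturm t ≡ 1F
  sturm-1 le = sturm≡1F t (to (floorMulφ-spec (suc t) (suc N)) le)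
  sturm-0 : floorMulφ (suc N) ≡ suc t → sturm t ≡ 0F
  sturm-0 eq = sturm≡0F t (λ lt → <-irrefl (sym eq) (from (floorMulφ-spec (suc t) (suc N)) lt))
  letters : SMblock N → SM (2 * t) ≡ 0F × SM (suc (2 * t)) ≡ Fin.suc (sturm t)
  letters (short G₊≡ s₀ s₁) = subst (λ u → SM (2 * u) ≡ 0F) t≡ s₀
                            , trans (cong (λ u → SM (suc (2 * u))) (sym t≡)) (trans s₁ (cong Fin.suc (sym (sturm-0 (trans G₊≡ (cong suc t≡))))))
    where
    t≡ : floorMulφ N ≡ t
    t≡ = ≤-antisym G≤t (s≤s⁻¹ (subst (t <_) G₊≡ t<G₊))
  letters (long G₊≡ s₀ s₁ s₂ s₃) with m≤n⇒∃[o]m+o≡n G≤t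
  ... | zero , t≡ = subst (λ u → SM (2 * u) ≡ 0F) t≡′ s₀
                  , trans (cong (λ u → SM (suc (2 * u))) (sym t≡′)) (trans s₁ (cong Fin.suc (sym (sturm-1 (≤-reflexive (trans (cong (suc ∘ suc) (sym t≡′)) (sym G₊≡)))))))
    where
    t≡′ : floorMulφ N ≡ t
    t≡′ = trans (sym (+-identityʳ _)) t≡
  ... | suc zero , t≡ = trans (cong SM (sym 2t≡)) s₂
                      , trans (cong (SM ∘ suc) (sym 2t≡)) (trans s₃ (cong Fin.suc (sym (sturm-0 (trans G₊≡ (cong suc t≡′))))))
    where
    t≡′ : suc (floorMulφ N) ≡ t
    t≡′ = trans (+-comm 1 _) t≡
    2t≡ : 2 + 2 * floorMulφ N ≡ 2 * t
    2t≡ = trans (sym (2*-suc (floorMulφ N))) (cong (2 *_) t≡′)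
  ... | suc (suc o) , t≡ = contradiction t<G₊ (≤⇒≯ (subst₂ _≤_ (sym G₊≡) t≡
                             (≤-trans (≤-reflexive (+-comm 2 (floorMulφ N))) (+-monoʳ-≤ (floorMulφ N) (s≤s (s≤s z≤n))))))

-- Right special factors of S^M and the Rauzy graph

odd : ℕ → Bool
odd zero    = false
odd (suc n) = not (odd n)

bit : Bool → ℕ
bit false = 0
bit true  = 1

odd-+ : ∀ m n → odd (m + n) ≡ odd m xor odd n
odd-+ zero    n = refl
odd-+ (suc m) n = trans (cong not (odd-+ m n)) (not-distribˡ-xor (odd m) (odd n))

odd-bit : ∀ b → odd (bit b) ≡ b
odd-bit false = refl
odd-bit true  = refl

halves : ∀ n → ∃[ h ] n ≡ bit (odd n) + 2 * h
halves zero = 0 , refl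
halves (suc n) with odd n | halves n
... | false | h , n≡ = h , cong suc n≡
... | true  | h , n≡ = suc h , trans (cong suc n≡) (sym (2*-suc h))

xor-cancelʳ : ∀ x y z → x xor z ≡ y xor z → x ≡ y
xor-cancelʳ false false z _ = refl
xor-cancelʳ true  true  z _ = refl
xor-cancelʳ false true  false ()
xor-cancelʳ false true  true  ()
xor-cancelʳ true  false false ()
xor-cancelʳ true  false true  ()

SM-even : ∀ h → SM (2 * h) ≡ 0F
SM-even h = proj₁ (SM-even-odd h)

SM-odd : ∀ h → SM (suc (2 * h)) ≡ Fin.suc (sturm h)
SM-odd h = proj₂ (SM-even-odd h)

SM≡0F⇔even : ∀ q → SM q ≡ 0F ⇔ odd q ≡ false
SM≡0F⇔even q with odd q | halves q
... | false | h , q≡ = mk⇔ (λ _ → refl) (λ _ → trans (cong SM q≡) (SM-even h))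
... | true  | h , q≡ = mk⇔ (λ SMq≡0 → contradiction (trans (sym (SM-odd h)) (trans (cong SM (sym q≡)) SMq≡0)) λ ()) (λ ())

odd-2* : ∀ h → odd (2 * h) ≡ false
odd-2* zero    = refl
odd-2* (suc h) = trans (cong odd (2*-suc h)) (trans (not-involutive (odd (2 * h))) (odd-2* h))

SM-parity : ∀ q q′ → SM q ≡ SM q′ → odd q ≡ odd q′
SM-parity q q′ same with odd q in oq | odd q′ in oq′
... | false | false = refl
... | true  | true  = refl
... | false | true  = contradiction (trans (sym oq′) (to (SM≡0F⇔even q′) (trans (sym same) (from (SM≡0F⇔even q) oq)))) λ ()
... | true  | false = contradiction (trans (sym oq) (to (SM≡0F⇔even q) (trans same (from (SM≡0F⇔even q′) oq′)))) λ ()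

-- The parity of a position is read off its letter, so equal factors end at positions of equal parity.
SM-zero-extension : ∀ q q′ {n} → 1 ≤ n → Agree SM q q′ n → SM (q + n) ≡ 0F → SM (q′ + n) ≡ 0F
SM-zero-extension q q′ {n} 1≤n agree ends-0 = from (SM≡0F⇔even (q′ + n)) (begin
  odd (q′ + n)       ≡⟨ odd-+ q′ n ⟩
  odd q′ xor odd n   ≡⟨ cong (_xor odd n) (sym first) ⟩
  odd q xor odd n    ≡⟨ sym (odd-+ q n) ⟩
  odd (q + n)        ≡⟨ to (SM≡0F⇔even (q + n)) ends-0 ⟩
  false              ∎)
  where
  open ≡-Reasoning
  first : odd q ≡ odd q′
  first = SM-parity q q′ (trans (cong SM (sym (+-identityʳ q))) (trans (agree 0 1≤n) (cong SM (+-identityʳ q′))))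

odd-offset : ∀ b s → ∃[ r ] bit b + r ≡ suc (2 * s)
odd-offset false s = suc (2 * s) , refl
odd-offset true  s = 2 * s , refl

module AlignedWindows (b : Bool) (n M : ℕ) (b+n≡2M+1 : bit b + n ≡ suc (2 * M)) where

  -- A window of length n starting at bit b + 2i sees exactly the letters sturm i, …, sturm (i + M − 1),
  -- at its odd positions, and is followed by (the successor of) sturm (i + M).
  position : ∀ i {r c s} → bit b + r ≡ c + 2 * s → bit b + 2 * i + r ≡ c + 2 * (i + s)
  position i {r} {c} {s} eq = begin
    bit b + 2 * i + r     ≡⟨ arith₁ (bit b) i r ⟩
    2 * i + (bit b + r)   ≡⟨ cong (2 * i +_) eq ⟩
    2 * i + (c + 2 * s)   ≡⟨ arith₂ i c s ⟩
    c + 2 * (i + s)       ∎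
    where
    open ≡-Reasoning
    arith₁ : ∀ o i r → o + 2 * i + r ≡ 2 * i + (o + r)
    arith₁ = solve-∀
    arith₂ : ∀ i c s → 2 * i + (c + 2 * s) ≡ c + 2 * (i + s)
    arith₂ = solve-∀

  inside : ∀ {r s} → r < n → bit b + r ≡ suc (2 * s) → s < M
  inside {r} {s} r<n eq = *-cancelˡ-< 2 s M (s≤s⁻¹ (subst₂ _<_ eq b+n≡2M+1 (+-monoʳ-< (bit b) r<n)))

  SM-after : ∀ i → SM (bit b + 2 * i + n) ≡ Fin.suc (sturm (i + M))
  SM-after i = trans (cong SM (position i {c = 1} b+n≡2M+1)) (SM-odd (i + M))

  SM-Agree : ∀ {i j} → Agree sturm i j M → Agree SM (bit b + 2 * i) (bit b + 2 * j) n
  SM-Agree {i} {j} agree r r<n with odd (bit b + r) | halves (bit b + r)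
  ... | false | s , eq = trans (cong SM (position i {c = 0} eq))
                          (trans (SM-even (i + s)) (sym (trans (cong SM (position j {c = 0} eq)) (SM-even (j + s)))))
  ... | true  | s , eq = trans (cong SM (position i {c = 1} eq)) (trans (SM-odd (i + s))
                          (trans (cong Fin.suc (agree s (inside r<n eq))) (sym (trans (cong SM (position j {c = 1} eq)) (SM-odd (j + s))))))

  SM-Agree⁻¹ : ∀ {i j} → Agree SM (bit b + 2 * i) (bit b + 2 * j) n → Agree sturm i j M
  SM-Agree⁻¹ {i} {j} agree s s<M with odd-offset b s
  ... | r , odd-pos = Fin-suc-injective (begin
    Fin.suc (sturm (i + s))     ≡⟨ sym (SM-odd (i + s)) ⟩
    SM (suc (2 * (i + s)))      ≡⟨ cong SM (sym (position i {c = 1} odd-pos)) ⟩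
    SM (bit b + 2 * i + r)      ≡⟨ agree r r<n ⟩
    SM (bit b + 2 * j + r)      ≡⟨ cong SM (position j {c = 1} odd-pos) ⟩
    SM (suc (2 * (j + s)))      ≡⟨ SM-odd (j + s) ⟩
    Fin.suc (sturm (j + s))     ∎)
    where
    open ≡-Reasoning
    r<n : r < n
    r<n = +-cancelˡ-< (bit b) r n (subst₂ _<_ (sym odd-pos) (sym b+n≡2M+1) (s<s (*-monoʳ-< 2 s<M)))

  SM-aligned : ∀ q → SM (q + n) ≢ 0F → ∃[ i ] q ≡ bit b + 2 * i
  SM-aligned q nonzero with halves q
  ... | i , q≡ = i , trans q≡ (cong (λ c → bit c + 2 * i) odd-q)
    where
    odd-q : odd q ≡ b
    odd-q = trans (xor-cancelʳ (odd q) (odd (bit b)) (odd n) (begin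
      odd q xor odd n         ≡⟨ sym (odd-+ q n) ⟩
      odd (q + n)             ≡⟨ odd-end ⟩
      true                    ≡⟨ cong not (sym (odd-2* M)) ⟩
      odd (suc (2 * M))       ≡⟨ cong odd (sym b+n≡2M+1) ⟩
      odd (bit b + n)         ≡⟨ odd-+ (bit b) n ⟩
      odd (bit b) xor odd n   ∎)) (odd-bit b)
      where
      open ≡-Reasoning
      odd-end : odd (q + n) ≡ true
      odd-end with odd (q + n) in o
      ... | true  = refl
      ... | false = contradiction (from (SM≡0F⇔even (q + n)) o) nonzero

  rightSpecial : ∃[ u ] RightSpecial SM n u 1F 2F
  rightSpecial = from-sturm (sturm-rightSpecial M)
    where
    from-sturm : ∃[ w ] RightSpecial sturm M w 0F 1F → ∃[ u ] RightSpecial SM n u 1F 2F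
    from-sturm (_ , (i , wi , i→0) , (j , wj , j→1)) =
      factorAt SM (bit b + 2 * i) n ,
      (bit b + 2 * i , refl , trans (SM-after i) (cong Fin.suc i→0)) ,
      (bit b + 2 * j , sym (Agree⇒factorAt-≡ SM (bit b + 2 * i) (bit b + 2 * j) n
                             (SM-Agree (factorAt-≡⇒Agree sturm i j M (trans wi (sym wj))))) ,
                       trans (SM-after j) (cong Fin.suc j→1))

  nonzero : ∀ q {c} → SM (q + n) ≡ Fin.suc c → SM (q + n) ≢ 0F
  nonzero q ends ends-0 = contradiction (trans (sym ends) ends-0) λ ()

  to-sturm : ∀ {w} → RightSpecial SM n w 1F 2F →
             ∃[ i ] factorAt SM (bit b + 2 * i) n ≡ w × RightSpecial sturm M (factorAt sturm i M) 0F 1F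
  to-sturm ((q , wq , q→1) , (q′ , wq′ , q′→2)) with SM-aligned q (nonzero q {0F} q→1) | SM-aligned q′ (nonzero q′ {1F} q′→2)
  ... | i , refl | j , refl =
    i , wq , (i , refl , Fin-suc-injective (trans (sym (SM-after i)) q→1)) ,
    (j , sym (Agree⇒factorAt-≡ sturm i j M (SM-Agree⁻¹ (factorAt-≡⇒Agree SM (bit b + 2 * i) (bit b + 2 * j) n (trans wq (sym wq′))))) ,
         Fin-suc-injective (trans (sym (SM-after j)) q′→2))

  rightSpecial-unique : ∀ {u v} → RightSpecial SM n u 1F 2F → RightSpecial SM n v 1F 2F → u ≡ v
  rightSpecial-unique {u} {v} special-u special-v = same-sturm (to-sturm special-u) (to-sturm special-v)
    where
    same-sturm : ∃[ i ] factorAt SM (bit b + 2 * i) n ≡ u × RightSpecial sturm M (factorAt sturm i M) 0F 1F →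
                 ∃[ i ] factorAt SM (bit b + 2 * i) n ≡ v × RightSpecial sturm M (factorAt sturm i M) 0F 1F → u ≡ v
    same-sturm (i , ui , si) (i′ , vi′ , si′) = trans (sym ui) (trans (Agree⇒factorAt-≡ SM (bit b + 2 * i) (bit b + 2 * i′) n
      (SM-Agree (factorAt-≡⇒Agree sturm i i′ M (sturm-rightSpecial-unique M si si′)))) vi′)

half-length : ∀ n → ∃[ M ] bit (not (odd n)) + n ≡ suc (2 * M)
half-length n with halves (bit (not (odd n)) + n)
... | M , eq = M , trans eq (cong (λ c → bit c + 2 * M) odd-sum)
  where
  odd-sum : odd (bit (not (odd n)) + n) ≡ true
  odd-sum = trans (odd-+ (bit (not (odd n))) n) (trans (cong (_xor odd n) (odd-bit (not (odd n))))
              (trans (sym (not-distribˡ-xor (odd n) (odd n))) (cong not (xor-same (odd n)))))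

SM-rightSpecial : ∀ n → ∃[ u ] RightSpecial SM n u 1F 2F
SM-rightSpecial n = AlignedWindows.rightSpecial (not (odd n)) n (proj₁ (half-length n)) (proj₂ (half-length n))

SM-rightSpecial-unique : ∀ n {u v} → RightSpecial SM n u 1F 2F → RightSpecial SM n v 1F 2F → u ≡ v
SM-rightSpecial-unique n = AlignedWindows.rightSpecial-unique (not (odd n)) n (proj₁ (half-length n)) (proj₂ (half-length n))

SM-extension-of-special : ∀ {n u a} → 1 ≤ n → RightSpecial SM n u 1F 2F → Extends SM n u a → a ≡ 1F ⊎ a ≡ 2F
SM-extension-of-special {n} {u} {0F} 1≤n ((q , uq , q→1) , _) (i , ui , i→0) = contradiction
  (trans (sym q→1) (SM-zero-extension i q 1≤n (factorAt-≡⇒Agree SM i q n (trans ui (sym uq))) i→0)) λ ()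
SM-extension-of-special {a = 1F} _ _ _ = inj₁ refl
SM-extension-of-special {a = 2F} _ _ _ = inj₂ refl

SM-special-of-two : ∀ {n w c c′} → 1 ≤ n → Extends SM n w c → Extends SM n w c′ → c ≢ c′ → RightSpecial SM n w 1F 2F
SM-special-of-two {n} {w} {0F} {c′} 1≤n (i , wi , i→0) (j , wj , j→c′) c≢c′ =
  contradiction (trans (sym j→c′) (SM-zero-extension i j 1≤n (factorAt-≡⇒Agree SM i j n (trans wi (sym wj))) i→0)) (c≢c′ ∘ sym)
SM-special-of-two {n} {w} {c} {0F} 1≤n (i , wi , i→c) (j , wj , j→0) c≢c′ =
  contradiction (trans (sym i→c) (SM-zero-extension j i 1≤n (factorAt-≡⇒Agree SM j i n (trans wj (sym wi))) j→0)) c≢c′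
SM-special-of-two {c = 1F} {1F} _ _ _ c≢c′ = contradiction refl c≢c′
SM-special-of-two {c = 1F} {2F} _ extends extends′ _ = extends , extends′
SM-special-of-two {c = 2F} {1F} _ extends extends′ _ = extends′ , extends
SM-special-of-two {c = 2F} {2F} _ _ _ c≢c′ = contradiction refl c≢c′

SM-degree-2 : ∀ n u → 1 ≤ n → RightSpecial SM n u 1F 2F → HasOutDegree SM u 2
SM-degree-2 n [] 1≤n special with Extends⇒IsVertex {x = SM} (proj₁ special)
... | _ , refl = contradiction 1≤n λ ()
SM-degree-2 n (b ∷ v) 1≤n special with Extends⇒IsVertex {x = SM} (proj₁ special)
... | _ , refl = outDegree-2 SM b v (λ ()) special (λ a → SM-extension-of-special {suc (length v)} {b ∷ v} {a} 1≤n special)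

SM-degree-1 : ∀ n u u′ → 1 ≤ n → RightSpecial SM n u 1F 2F → IsVertex SM n u′ → u′ ≢ u → HasOutDegree SM u′ 1
SM-degree-1 n u []      1≤n special (_ , refl)          u′≢u = contradiction 1≤n λ ()
SM-degree-1 n u (b ∷ v) 1≤n special ((i , factor) , refl) u′≢u =
  outDegree-1 SM b v (SM (i + suc (length v))) extends only
  where
  extends : Extends SM (suc (length v)) (b ∷ v) (SM (i + suc (length v)))
  extends = i , factor , refl
  only : ∀ a → Extends SM (suc (length v)) (b ∷ v) a → a ≡ SM (i + suc (length v))
  only a extends′ with a ≟ᶠ SM (i + suc (length v))
  ... | yes a≡ = a≡
  ... | no a≢ = contradiction (SM-rightSpecial-unique (suc (length v)) {b ∷ v} {u}
                  (SM-special-of-two {suc (length v)} {b ∷ v} {a} {SM (i + suc (length v))} 1≤n extends′ extends a≢) special) u′≢u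

theorem4p5 : (n : ℕ) → n ≥ 1 →
    Σ (List (Fin 3)) λ u → IsVertex SM n u × HasOutDegree SM u 2 ×
      ((u′ : List (Fin 3)) → IsVertex SM n u′ → u′ ≢ u → HasOutDegree SM u′ 1)
theorem4p5 n n≥1 = vertex-of (SM-rightSpecial n)
  where
  vertex-of : ∃[ u ] RightSpecial SM n u 1F 2F →
              Σ (List (Fin 3)) λ u → IsVertex SM n u × HasOutDegree SM u 2 ×
                ((u′ : List (Fin 3)) → IsVertex SM n u′ → u′ ≢ u → HasOutDegree SM u′ 1)
  vertex-of (u , special) = u , Extends⇒IsVertex {x = SM} {n} {u} {1F} (proj₁ special) , SM-degree-2 n u n≥1 special ,
                            λ u′ vertex u′≢u → SM-degree-1 n u u′ n≥1 special vertex u′≢u
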